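{- Let $p$ be a prime, $q$ a power of $p$, and $\mathbb{F}_q$ the field with $q$ elements. Fix any bijection $\varphi:\mathbb{F}_q\to\{0,1,\dots,q-1\}$ with $\varphi(0)=0$, and for a matrix $K$ over $\mathbb{F}_q$ let $s(K)=\varphi(\sigma(K))$, where $\sigma(K)\in\mathbb{F}_q$ is the sum of all entries of $K$ computed in $\mathbb{F}_q$. Let $\omega_q$ be a primitive complex $q$-th root of unity. Then for every $n\ge 1$, $$\sum_{K\in GL_n(\mathbb{F}_q)}\omega_q^{s(K)}=-(q-1)^{n-1}q^{\binom n2}[n-1]_q!.$$
   Context: For an integer $m\ge1$, $[m]_q=1+q+\cdots+q^{m-1}=\frac{1-q^m}{1-q}$, and $[m]_q!=[m]_q[m-1]_q\cdots[1]_q$, with $[0]_q!=1$. -}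

module Defs where

open import Level using (0ℓ)
open import Algebra.Bundles using (CommutativeRing)
open import Data.Nat using (ℕ; zero; suc; _≤_; _^_; _∸_) renaming (_+_ to _+ℕ_; _*_ to _*ℕ_)
open import Data.Nat.Combinatorics using (_C_)
open import Data.Fin using (Fin; toℕ; _≟_)
open import Data.Fin.Base using (suc)
import Data.Fin as Fin
open import Data.List using (List; []; _∷_; map; concatMap; filter; foldr; allFin)
open import Data.Vec.Functional using () renaming (_∷_ to _∷ᶠ_)
open import Data.Product using (Σ; _×_; _,_)
open import Relation.Nullary using (¬_; Dec; yes; no)
open import Relation.Binary.PropositionalEquality using (_≡_)

module Ops (R : CommutativeRing 0ℓ 0ℓ) where
  open CommutativeRing R hiding (zero)

  pow : Carrier → ℕ → Carrier
  pow x zero = 1#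
  pow x (suc m) = x * pow x m

  fromℕ : ℕ → Carrier
  fromℕ zero = 0#
  fromℕ (suc m) = 1# + fromℕ m

  ΣFin : (m : ℕ) → (Fin m → Carrier) → Carrier
  ΣFin zero f = 0#
  ΣFin (suc m) f = f Fin.zero + ΣFin m (λ i → f (suc i))

  ΣList : {A : Set} → List A → (A → Carrier) → Carrier
  ΣList xs f = foldr (λ a acc → f a + acc) 0# xs

  record IsField : Set where
    field
      1≉0 : ¬ (1# ≈ 0#)
      inverse : ∀ x → ¬ (x ≈ 0#) → Σ Carrier (λ y → x * y ≈ 1#)

  CharZero : Set
  CharZero = ∀ m → ¬ (fromℕ (suc m) ≈ 0#)

  IsPrimitiveRoot : ℕ → Carrier → Set
  IsPrimitiveRoot N ω = (pow ω N ≈ 1#) × (∀ j → 1 ≤ j → suc j ≤ N → ¬ (pow ω j ≈ 1#))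

  Matrix : ℕ → Set
  Matrix n = Fin n → Fin n → Carrier

  _≈M_ : {n : ℕ} → Matrix n → Matrix n → Set
  A ≈M B = ∀ i j → A i j ≈ B i j

  mulM : {n : ℕ} → Matrix n → Matrix n → Matrix n
  mulM {n} A B i j = ΣFin n (λ k → A i k * B k j)

  idM : {n : ℕ} → Matrix n
  idM i j with i ≟ j
  ... | yes _ = 1#
  ... | no _ = 0#

  Invertible : {n : ℕ} → Matrix n → Set
  Invertible {n} K = Σ (Matrix n) (λ L → (mulM K L ≈M idM) × (mulM L K ≈M idM))

  σ : {n : ℕ} → Matrix n → Carrier
  σ {n} K = ΣFin n (λ i → ΣFin n (λ j → K i j))

module _ (F : CommutativeRing 0ℓ 0ℓ) where
  open CommutativeRing F hiding (zero)
  record IsBijection (N : ℕ) (φ : Carrier → Fin N) (ψ : Fin N → Carrier) : Set where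
    field
      φ-cong : ∀ {x y} → x ≈ y → φ x ≡ φ y
      φψ : ∀ i → φ (ψ i) ≡ i
      ψφ : ∀ x → ψ (φ x) ≈ x

allFuns : {A : Set} → List A → (m : ℕ) → List (Fin m → A)
allFuns xs zero = (λ ()) ∷ []
allFuns xs (suc m) = concatMap (λ x → map (λ f → x ∷ᶠ f) (allFuns xs m)) xs

-- all n × n matrices with entries in F, each represented once (entries ψ(0),…,ψ(N-1))
allMatrices : (F : CommutativeRing 0ℓ 0ℓ) (N : ℕ) → (Fin N → CommutativeRing.Carrier F) →
              (n : ℕ) → List (Ops.Matrix F n)
allMatrices F N ψ n = allFuns (allFuns (map ψ (allFin N)) n) n

GLSum : (F : CommutativeRing 0ℓ 0ℓ) (R : CommutativeRing 0ℓ 0ℓ) (N : ℕ)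
        (φ : CommutativeRing.Carrier F → Fin N) (ψ : Fin N → CommutativeRing.Carrier F)
        (ω : CommutativeRing.Carrier R) (n : ℕ)
        (inv? : (K : Ops.Matrix F n) → Dec (Ops.Invertible F K)) → CommutativeRing.Carrier R
GLSum F R N φ ψ ω n inv? =
  Ops.ΣList R (filter inv? (allMatrices F N ψ n)) (λ K → Ops.pow R ω (toℕ (φ (Ops.σ F K))))

qint : ℕ → ℕ → ℕ
qint q zero = 0
qint q (suc m) = 1 +ℕ q *ℕ qint q m

qfact : ℕ → ℕ → ℕ
qfact q zero = 1
qfact q (suc m) = qint q (suc m) *ℕ qfact q m

rhsNat : ℕ → ℕ → ℕ
rhsNat q n = (q ∸ 1) ^ (n ∸ 1) *ℕ q ^ (n C 2) *ℕ qfact q (n ∸ 1)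

{-# OPTIONS --safe #-}
-- Left multiplication by the invertible matrix S = I + e₀(e₀ − 𝟏)ᵀ, whose columns sum to e₀,
-- turns σ(K) into the sum of the first row of K. Right multiplication by invertible matrices
-- moves any nonzero row to any other, so every nonzero vector is the first row of the same
-- number C = q^(n−1)·|GL_(n−1)| of invertible matrices, and the zero vector of none. Hence the
-- sum is C·(Σ_{r ∈ F^n} ω^φ(Σr) − 1) = −C, because translating the first coordinate gives
-- Σ_{r ∈ F^n} ω^φ(Σr) = q^(n−1)·Σ_{x ∈ F} ω^φ(x) = q^(n−1)·Σ_{i<q} ω^i = 0.
-- The same fibre count gives |GL_n| = (q^n − 1)·C, which yields the closed form for C.
module Submission where

open import Defs
open import Level using (0ℓ)
open import Algebra.Bundles using (CommutativeRing)
open import Data.Nat using (ℕ; zero; suc; _≤_; _^_)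
import Data.Nat as ℕ
import Data.Nat.Properties as ℕ
open import Data.Nat.Primality using (Prime; prime⇒nonTrivial; prime⇒nonZero)
open import Data.Fin using (Fin; toℕ)
import Data.Fin as Fin
open import Data.Fin.Properties using (toℕ-inject₁; toℕ-fromℕ; ¬∀⟶∃¬)
open import Data.List using (List; []; _∷_; _++_; map; concatMap; filter; length; tabulate; allFin)
open import Data.Vec.Functional using (Vector) renaming (_∷_ to _∷ᶠ_)
import Data.Vec.Functional.Relation.Binary.Pointwise as Pointwise
import Data.Vec.Functional.Relation.Binary.Pointwise.Properties as Pointwise
open import Data.Product using (_×_; _,_; proj₁; proj₂)
open import Function using (_∘_; _⇔_; mk⇔; Equivalence; Inverse)
open import Relation.Binary using (_Preserves_⟶_)
open import Relation.Binary.Bundles using (Setoid; DecSetoid)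
open import Relation.Binary.PropositionalEquality using (_≡_; _≢_)
import Relation.Binary.PropositionalEquality as P
open import Relation.Nullary using (Dec; yes; no; ¬_; _×-dec_; contradiction)
import Relation.Nullary.Decidable as Dec

module FiniteSums (R : CommutativeRing 0ℓ 0ℓ) where
  open CommutativeRing R hiding (zero)
  open Ops R using (ΣFin; ΣList; fromℕ)
  open import Algebra.Properties.Semiring.Sum semiring
    using (sum; sum-cong-≋; sum-replicate-zero; sum-init-last; ∑-distrib-+; ∑-comm; *-distribˡ-sum; *-distribʳ-sum)
  open import Algebra.Properties.Semiring.Mult semiring using (×1-homo-*) renaming (_×_ to _·_)
  open import Algebra.Properties.AbelianGroup +-abelianGroup using (⁻¹-∙-comm; xyx⁻¹≈y)
  open import Algebra.Properties.Ring ring using (-0#≈0#)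
  open import Relation.Binary.Reasoning.Setoid setoid

  ΣFin≡sum : ∀ m (f : Fin m → Carrier) → ΣFin m f ≡ sum f
  ΣFin≡sum zero    f = P.refl
  ΣFin≡sum (suc m) f = P.cong (f Fin.zero +_) (ΣFin≡sum m (f ∘ Fin.suc))

  private
    sum⇒ΣFin : ∀ m n {f : Fin m → Carrier} {g : Fin n → Carrier} → sum {m} f ≈ sum {n} g → ΣFin m f ≈ ΣFin n g
    sum⇒ΣFin m n {f} {g} eq = trans (reflexive (ΣFin≡sum m f)) (trans eq (reflexive (P.sym (ΣFin≡sum n g))))

  ΣFin-cong : ∀ m {f g : Fin m → Carrier} → (∀ i → f i ≈ g i) → ΣFin m f ≈ ΣFin m g
  ΣFin-cong m f≈g = sum⇒ΣFin m m (sum-cong-≋ {m} f≈g)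

  fromℕ≡·1# : ∀ m → fromℕ m ≡ m · 1#
  fromℕ≡·1# zero    = P.refl
  fromℕ≡·1# (suc m) = P.cong (1# +_) (fromℕ≡·1# m)

  fromℕ-* : ∀ m n → fromℕ (m ℕ.* n) ≈ fromℕ m * fromℕ n
  fromℕ-* m n = begin
    fromℕ (m ℕ.* n)      ≡⟨ fromℕ≡·1# (m ℕ.* n) ⟩
    (m ℕ.* n) · 1#       ≈⟨ ×1-homo-* m n ⟩
    m · 1# * n · 1#      ≡⟨ P.cong₂ _*_ (fromℕ≡·1# m) (fromℕ≡·1# n) ⟨
    fromℕ m * fromℕ n    ∎

  fromℕ-∸1 : ∀ k → 1 ≤ k → fromℕ (k ℕ.∸ 1) ≈ fromℕ k + - 1#
  fromℕ-∸1 (suc k) _ = sym (xyx⁻¹≈y 1# (fromℕ k))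

  ΣFin-zero : ∀ m → ΣFin m (λ _ → 0#) ≈ 0#
  ΣFin-zero m = trans (reflexive (ΣFin≡sum m _)) (sum-replicate-zero m)

  ΣFin-distrib-+ : ∀ m (f g : Fin m → Carrier) → ΣFin m (λ i → f i + g i) ≈ ΣFin m f + ΣFin m g
  ΣFin-distrib-+ m f g = begin
    ΣFin m (λ i → f i + g i)  ≡⟨ ΣFin≡sum m _ ⟩
    sum {m} (λ i → f i + g i) ≈⟨ ∑-distrib-+ f g ⟩
    sum f + sum g             ≡⟨ P.cong₂ _+_ (ΣFin≡sum m f) (ΣFin≡sum m g) ⟨
    ΣFin m f + ΣFin m g       ∎

  *-distribˡ-ΣFin : ∀ m c (f : Fin m → Carrier) → c * ΣFin m f ≈ ΣFin m (λ i → c * f i)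
  *-distribˡ-ΣFin m c f = trans (*-congˡ (reflexive (ΣFin≡sum m f))) (trans (*-distribˡ-sum c f) (reflexive (P.sym (ΣFin≡sum m _))))

  *-distribʳ-ΣFin : ∀ m c (f : Fin m → Carrier) → ΣFin m f * c ≈ ΣFin m (λ i → f i * c)
  *-distribʳ-ΣFin m c f = trans (*-congʳ (reflexive (ΣFin≡sum m f))) (trans (*-distribʳ-sum c f) (reflexive (P.sym (ΣFin≡sum m _))))

  ΣFin-comm : ∀ m n (f : Fin m → Fin n → Carrier) →
              ΣFin m (λ i → ΣFin n (f i)) ≈ ΣFin n (λ j → ΣFin m (λ i → f i j))
  ΣFin-comm m n f = sum⇒ΣFin m n (begin
    sum {m} (λ i → ΣFin n (f i))           ≈⟨ sum-cong-≋ {m} (λ i → reflexive (ΣFin≡sum n (f i))) ⟩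
    sum {m} (λ i → sum {n} (f i))          ≈⟨ ∑-comm f ⟩
    sum {n} (λ j → sum {m} (λ i → f i j))  ≈⟨ sum-cong-≋ {n} (λ j → reflexive (P.sym (ΣFin≡sum m _))) ⟩
    sum {n} (λ j → ΣFin m (λ i → f i j))   ∎)

  ΣFin-init-last : ∀ m (f : Fin (suc m) → Carrier) → ΣFin (suc m) f ≈ ΣFin m (f ∘ Fin.inject₁) + f (Fin.fromℕ m)
  ΣFin-init-last m f = begin
    ΣFin (suc m) f                                ≡⟨ ΣFin≡sum (suc m) f ⟩
    sum {suc m} f                                 ≈⟨ sum-init-last f ⟩
    sum {m} (f ∘ Fin.inject₁) + f (Fin.fromℕ m)  ≡⟨ P.cong (_+ f (Fin.fromℕ m)) (ΣFin≡sum m _) ⟨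
    ΣFin m (f ∘ Fin.inject₁) + f (Fin.fromℕ m)   ∎

  ΣFin-neg : ∀ m (f : Fin m → Carrier) → ΣFin m (λ i → - f i) ≈ - ΣFin m f
  ΣFin-neg zero    f = sym -0#≈0#
  ΣFin-neg (suc m) f = trans (+-congˡ (ΣFin-neg m (f ∘ Fin.suc))) (⁻¹-∙-comm _ _)

  ΣList-cong : ∀ {A : Set} (xs : List A) {f g : A → Carrier} → (∀ x → f x ≈ g x) → ΣList xs f ≈ ΣList xs g
  ΣList-cong []       f≈g = refl
  ΣList-cong (x ∷ xs) f≈g = +-cong (f≈g x) (ΣList-cong xs f≈g)

  ΣList-const : ∀ {A : Set} (xs : List A) c → ΣList xs (λ _ → c) ≈ fromℕ (length xs) * c
  ΣList-const []       c = sym (zeroˡ c)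
  ΣList-const (x ∷ xs) c = trans (+-cong (sym (*-identityˡ c)) (ΣList-const xs c)) (sym (distribʳ c 1# _))

  ΣList-zero : ∀ {A : Set} (xs : List A) → ΣList xs (λ _ → 0#) ≈ 0#
  ΣList-zero xs = trans (ΣList-const xs 0#) (zeroʳ _)

  ΣList-distrib-+ : ∀ {A : Set} (xs : List A) (f g : A → Carrier) →
                    ΣList xs (λ x → f x + g x) ≈ ΣList xs f + ΣList xs g
  ΣList-distrib-+ []       f g = sym (+-identityʳ 0#)
  ΣList-distrib-+ (x ∷ xs) f g = trans (+-congˡ (ΣList-distrib-+ xs f g)) (interchange _ _ _ _)
    where open import Algebra.Properties.CommutativeSemigroup +-commutativeSemigroup using (interchange)

  ΣList-neg : ∀ {A : Set} (xs : List A) (f : A → Carrier) → ΣList xs (λ x → - f x) ≈ - ΣList xs f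
  ΣList-neg []       f = sym -0#≈0#
  ΣList-neg (x ∷ xs) f = trans (+-congˡ (ΣList-neg xs f)) (⁻¹-∙-comm _ _)

  *-distribˡ-ΣList : ∀ {A : Set} (xs : List A) c (f : A → Carrier) → c * ΣList xs f ≈ ΣList xs (λ x → c * f x)
  *-distribˡ-ΣList []       c f = zeroʳ c
  *-distribˡ-ΣList (x ∷ xs) c f = trans (distribˡ c _ _) (+-congˡ (*-distribˡ-ΣList xs c f))

  *-distribʳ-ΣList : ∀ {A : Set} (xs : List A) c (f : A → Carrier) → ΣList xs f * c ≈ ΣList xs (λ x → f x * c)
  *-distribʳ-ΣList []       c f = zeroˡ c
  *-distribʳ-ΣList (x ∷ xs) c f = trans (distribʳ c _ _) (+-congˡ (*-distribʳ-ΣList xs c f))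

  ΣList-comm : ∀ {A B : Set} (xs : List A) (ys : List B) (f : A → B → Carrier) →
               ΣList xs (λ x → ΣList ys (f x)) ≈ ΣList ys (λ y → ΣList xs (λ x → f x y))
  ΣList-comm []       ys f = sym (ΣList-zero ys)
  ΣList-comm (x ∷ xs) ys f = trans (+-congˡ (ΣList-comm xs ys f)) (sym (ΣList-distrib-+ ys _ _))

  ΣList-++ : ∀ {A : Set} (xs ys : List A) (f : A → Carrier) → ΣList (xs ++ ys) f ≈ ΣList xs f + ΣList ys f
  ΣList-++ []       ys f = sym (+-identityˡ _)
  ΣList-++ (x ∷ xs) ys f = trans (+-congˡ (ΣList-++ xs ys f)) (sym (+-assoc _ _ _))

  ΣList-map : ∀ {A B : Set} (h : A → B) (xs : List A) (f : B → Carrier) → ΣList (map h xs) f ≈ ΣList xs (f ∘ h)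
  ΣList-map h []       f = refl
  ΣList-map h (x ∷ xs) f = +-congˡ (ΣList-map h xs f)

  ΣList-concatMap : ∀ {A B : Set} (g : A → List B) (xs : List A) (f : B → Carrier) →
                    ΣList (concatMap g xs) f ≈ ΣList xs (λ x → ΣList (g x) f)
  ΣList-concatMap g []       f = refl
  ΣList-concatMap g (x ∷ xs) f = trans (ΣList-++ (g x) (concatMap g xs) f) (+-congˡ (ΣList-concatMap g xs f))

  ΣList-tabulate : ∀ n {B : Set} (h : Fin n → B) (f : B → Carrier) → ΣList (tabulate h) f ≈ ΣFin n (f ∘ h)
  ΣList-tabulate zero    h f = refl
  ΣList-tabulate (suc n) h f = +-congˡ (ΣList-tabulate n (h ∘ Fin.suc) f)

  𝟙 : {Q : Set} → Dec Q → Carrier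
  𝟙 (yes _) = 1#
  𝟙 (no _)  = 0#

  𝟙-yes : {Q : Set} → Q → (d : Dec Q) → 𝟙 d ≈ 1#
  𝟙-yes q (yes _) = refl
  𝟙-yes q (no ¬q) = contradiction q ¬q

  𝟙-no : {Q : Set} → ¬ Q → (d : Dec Q) → 𝟙 d ≈ 0#
  𝟙-no ¬q (yes q) = contradiction q ¬q
  𝟙-no ¬q (no _)  = refl

  𝟙-cong : {Q Q′ : Set} → Q ⇔ Q′ → (d : Dec Q) (d′ : Dec Q′) → 𝟙 d ≈ 𝟙 d′
  𝟙-cong Q⇔Q′ (yes q) d′ = sym (𝟙-yes (Equivalence.to Q⇔Q′ q) d′)
  𝟙-cong Q⇔Q′ (no ¬q) d′ = sym (𝟙-no (¬q ∘ Equivalence.from Q⇔Q′) d′)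

  𝟙-×-dec : {Q Q′ : Set} (d : Dec Q) (d′ : Dec Q′) → 𝟙 (d ×-dec d′) ≈ 𝟙 d * 𝟙 d′
  𝟙-×-dec (yes _) (yes _) = sym (*-identityˡ 1#)
  𝟙-×-dec (yes _) (no _)  = sym (zeroʳ 1#)
  𝟙-×-dec (no _)  _       = sym (zeroˡ _)

  ΣList-filter : ∀ {A : Set} {Q : A → Set} (Q? : ∀ x → Dec (Q x)) (xs : List A) (f : A → Carrier) →
                 ΣList (filter Q? xs) f ≈ ΣList xs (λ x → 𝟙 (Q? x) * f x)
  ΣList-filter Q? []       f = refl
  ΣList-filter Q? (x ∷ xs) f with Q? x
  ... | yes _ = +-cong (sym (*-identityˡ _)) (ΣList-filter Q? xs f)
  ... | no _  = trans (ΣList-filter Q? xs f) (sym (trans (+-congʳ (zeroˡ _)) (+-identityˡ _)))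

  ΣList-allFuns-suc : ∀ {A : Set} (xs : List A) m (h : (Fin (suc m) → A) → Carrier) →
    ΣList (allFuns xs (suc m)) h ≈ ΣList xs (λ x → ΣList (allFuns xs m) (λ f → h (x ∷ᶠ f)))
  ΣList-allFuns-suc xs m h =
    trans (ΣList-concatMap _ xs h) (ΣList-cong xs (λ x → ΣList-map (x ∷ᶠ_) (allFuns xs m) h))

  ΣList-allFuns-const : ∀ {A : Set} (xs : List A) m c → ΣList (allFuns xs m) (λ _ → c) ≈ fromℕ (length xs ^ m) * c
  ΣList-allFuns-const xs zero    c = trans (+-identityʳ c) (sym (trans (*-congʳ (+-identityʳ 1#)) (*-identityˡ c)))
  ΣList-allFuns-const xs (suc m) c = begin
    ΣList (allFuns xs (suc m)) (λ _ → c)                    ≈⟨ ΣList-allFuns-suc xs m _ ⟩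
    ΣList xs (λ _ → ΣList (allFuns xs m) (λ _ → c))         ≈⟨ ΣList-cong xs (λ _ → ΣList-allFuns-const xs m c) ⟩
    ΣList xs (λ _ → fromℕ (length xs ^ m) * c)              ≈⟨ ΣList-const xs _ ⟩
    fromℕ (length xs) * (fromℕ (length xs ^ m) * c)         ≈⟨ *-assoc _ _ c ⟨
    fromℕ (length xs) * fromℕ (length xs ^ m) * c           ≈⟨ *-congʳ (fromℕ-* (length xs) _) ⟨
    fromℕ (length xs ^ suc m) * c                           ∎

  ΣList-allFuns-columns : ∀ {A : Set} (xs : List A) m k (H : (Fin k → Fin (suc m) → A) → Carrier) →
    (∀ {K K′} → (∀ i j → K i j ≡ K′ i j) → H K ≈ H K′) →
    ΣList (allFuns (allFuns xs (suc m)) k) H ≈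
      ΣList (allFuns xs k) (λ t → ΣList (allFuns (allFuns xs m) k) (λ M → H (λ i → t i ∷ᶠ M i)))
  ΣList-allFuns-columns xs m zero    H H-cong = +-congʳ (trans (H-cong (λ ())) (sym (+-identityʳ _)))
  ΣList-allFuns-columns xs m (suc k) H H-cong = begin
    ΣList (Rows (suc m) (suc k)) H
      ≈⟨ ΣList-allFuns-suc (allFuns xs (suc m)) k H ⟩
    ΣList (allFuns xs (suc m)) (λ r → ΣList (Rows (suc m) k) (λ K → H (r ∷ᶠ K)))
      ≈⟨ ΣList-cong (allFuns xs (suc m)) (λ r → ΣList-allFuns-columns xs m k (λ K → H (r ∷ᶠ K))
           (λ K≡K′ → H-cong λ { Fin.zero j → P.refl ; (Fin.suc i) j → K≡K′ i j })) ⟩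
    ΣList (allFuns xs (suc m)) (λ r → ΣList (allFuns xs k) (λ t → ΣList (Rows m k) (λ M → H (r ∷ᶠ (λ i → t i ∷ᶠ M i)))))
      ≈⟨ ΣList-allFuns-suc xs m _ ⟩
    ΣList xs (λ x → ΣList (allFuns xs m) (λ v → ΣList (allFuns xs k) (λ t → ΣList (Rows m k) (λ M →
      H ((x ∷ᶠ v) ∷ᶠ (λ i → t i ∷ᶠ M i))))))
      ≈⟨ ΣList-cong xs (λ x → ΣList-comm (allFuns xs m) (allFuns xs k) _) ⟩
    ΣList xs (λ x → ΣList (allFuns xs k) (λ t → ΣList (allFuns xs m) (λ v → ΣList (Rows m k) (λ M →
      H ((x ∷ᶠ v) ∷ᶠ (λ i → t i ∷ᶠ M i))))))
      ≈⟨ ΣList-cong xs (λ x → ΣList-cong (allFuns xs k) (λ t → ΣList-cong (allFuns xs m) (λ v → ΣList-cong (Rows m k) (λ M →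
           H-cong λ { Fin.zero j → P.refl ; (Fin.suc i) j → P.refl }))))  ⟩
    ΣList xs (λ x → ΣList (allFuns xs k) (λ t → ΣList (allFuns xs m) (λ v → ΣList (Rows m k) (λ M →
      H (λ i → (x ∷ᶠ t) i ∷ᶠ (v ∷ᶠ M) i)))))
      ≈⟨ ΣList-cong xs (λ x → ΣList-cong (allFuns xs k) (λ t → ΣList-allFuns-suc (allFuns xs m) k _)) ⟨
    ΣList xs (λ x → ΣList (allFuns xs k) (λ t → ΣList (Rows m (suc k)) (λ M → H (λ i → (x ∷ᶠ t) i ∷ᶠ M i))))
      ≈⟨ ΣList-allFuns-suc xs k _ ⟨
    ΣList (allFuns xs (suc k)) (λ t → ΣList (Rows m (suc k)) (λ M → H (λ i → t i ∷ᶠ M i)))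
      ∎
    where
    Rows : ∀ m k → List (Fin k → Fin m → _)
    Rows m k = allFuns (allFuns xs m) k

module Enumerations (R : CommutativeRing 0ℓ 0ℓ) where
  open CommutativeRing R hiding (zero)
  open Ops R using (ΣList)
  open FiniteSums R
  open import Relation.Binary.Reasoning.Setoid setoid

  -- "Exactly once" is only asked as a count in R: that is all the summation arguments use.
  record Enumeration (S : DecSetoid 0ℓ 0ℓ) : Set where
    open DecSetoid S using (_≟_) renaming (Carrier to A)
    field
      elements    : List A
      counts-once : ∀ y → ΣList elements (λ x → 𝟙 (x ≟ y)) ≈ 1#

  open Enumeration public

  module _ {S : DecSetoid 0ℓ 0ℓ} (E : Enumeration S) where
    private module S = DecSetoid S

    ΣList-select : ∀ {f : S.Carrier → Carrier} → f Preserves S._≈_ ⟶ _≈_ →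
                   ∀ y → ΣList (elements E) (λ x → 𝟙 (x S.≟ y) * f x) ≈ f y
    ΣList-select {f} f-cong y = begin
      ΣList (elements E) (λ x → 𝟙 (x S.≟ y) * f x)  ≈⟨ ΣList-cong (elements E) select-y ⟩
      ΣList (elements E) (λ x → 𝟙 (x S.≟ y) * f y)  ≈⟨ *-distribʳ-ΣList (elements E) (f y) _ ⟨
      ΣList (elements E) (λ x → 𝟙 (x S.≟ y)) * f y  ≈⟨ *-congʳ (counts-once E y) ⟩
      1# * f y                                      ≈⟨ *-identityˡ (f y) ⟩
      f y                                           ∎
      where
      select-y : ∀ x → 𝟙 (x S.≟ y) * f x ≈ 𝟙 (x S.≟ y) * f y
      select-y x with x S.≟ y
      ... | yes x≈y = *-congˡ (f-cong x≈y)
      ... | no _    = trans (zeroˡ (f x)) (sym (zeroˡ (f y)))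

  ΣList-reindex : ∀ {S T : DecSetoid 0ℓ 0ℓ} (E : Enumeration S) (E′ : Enumeration T)
                  (e : Inverse (DecSetoid.setoid T) (DecSetoid.setoid S)) {f : DecSetoid.Carrier S → Carrier} →
                  f Preserves DecSetoid._≈_ S ⟶ _≈_ → ΣList (elements E) f ≈ ΣList (elements E′) (f ∘ Inverse.to e)
  ΣList-reindex {S} {T} E E′ e {f} f-cong = begin
    ΣList (elements E) f
      ≈⟨ ΣList-cong (elements E) (λ x → trans (sym (*-identityʳ (f x))) (*-congˡ (sym (counts-once E′ (from x))))) ⟩
    ΣList (elements E) (λ x → f x * ΣList (elements E′) (λ y → 𝟙 (y T.≟ from x)))
      ≈⟨ ΣList-cong (elements E) (λ x → *-distribˡ-ΣList (elements E′) (f x) _) ⟩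
    ΣList (elements E) (λ x → ΣList (elements E′) (λ y → f x * 𝟙 (y T.≟ from x)))
      ≈⟨ ΣList-comm (elements E) (elements E′) _ ⟩
    ΣList (elements E′) (λ y → ΣList (elements E) (λ x → f x * 𝟙 (y T.≟ from x)))
      ≈⟨ ΣList-cong (elements E′) (λ y → ΣList-cong (elements E) (λ x →
           trans (*-comm _ _) (*-congʳ (𝟙-cong (mk⇔ (S.sym ∘ inverseˡ) (T.sym ∘ inverseʳ)) (y T.≟ from x) (x S.≟ to y))))) ⟩
    ΣList (elements E′) (λ y → ΣList (elements E) (λ x → 𝟙 (x S.≟ to y) * f x))
      ≈⟨ ΣList-cong (elements E′) (λ y → ΣList-select E f-cong (to y)) ⟩
    ΣList (elements E′) (f ∘ to)
      ∎
    where
    module S = DecSetoid S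
    module T = DecSetoid T
    open Inverse e

  vectors : ∀ {S : DecSetoid 0ℓ 0ℓ} → Enumeration S → ∀ m → Enumeration (Pointwise.decSetoid S m)
  vectors {S} E m = record { elements = allFuns (elements E) m ; counts-once = counts-once-vectors m }
    where
    module S = DecSetoid S
    _≟ᵐ_ : ∀ {m} (f g : Fin m → S.Carrier) → Dec (Pointwise.Pointwise S._≈_ f g)
    _≟ᵐ_ {m} = DecSetoid._≟_ (Pointwise.decSetoid S m)

    counts-once-vectors : ∀ m (g : Fin m → S.Carrier) → ΣList (allFuns (elements E) m) (λ f → 𝟙 (f ≟ᵐ g)) ≈ 1#
    counts-once-vectors zero    g = trans (+-identityʳ _) (𝟙-yes (λ ()) ((λ ()) ≟ᵐ g))
    counts-once-vectors (suc m) g = begin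
      ΣList (allFuns (elements E) (suc m)) (λ f → 𝟙 (f ≟ᵐ g))
        ≈⟨ ΣList-allFuns-suc (elements E) m _ ⟩
      ΣList (elements E) (λ x → ΣList (allFuns (elements E) m) (λ f → 𝟙 ((x ∷ᶠ f) ≟ᵐ g)))
        ≈⟨ ΣList-cong (elements E) (λ x → ΣList-cong (allFuns (elements E) m) (λ f →
             trans (𝟙-cong cons-≈ ((x ∷ᶠ f) ≟ᵐ g) (x S.≟ g Fin.zero ×-dec f ≟ᵐ (g ∘ Fin.suc)))
                   (𝟙-×-dec (x S.≟ g Fin.zero) (f ≟ᵐ (g ∘ Fin.suc))))) ⟩
      ΣList (elements E) (λ x → ΣList (allFuns (elements E) m) (λ f → 𝟙 (x S.≟ g Fin.zero) * 𝟙 (f ≟ᵐ (g ∘ Fin.suc))))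
        ≈⟨ ΣList-cong (elements E) (λ x → *-distribˡ-ΣList (allFuns (elements E) m) _ _) ⟨
      ΣList (elements E) (λ x → 𝟙 (x S.≟ g Fin.zero) * ΣList (allFuns (elements E) m) (λ f → 𝟙 (f ≟ᵐ (g ∘ Fin.suc))))
        ≈⟨ ΣList-cong (elements E) (λ x → trans (*-congˡ (counts-once-vectors m (g ∘ Fin.suc))) (*-identityʳ _)) ⟩
      ΣList (elements E) (λ x → 𝟙 (x S.≟ g Fin.zero))
        ≈⟨ counts-once E (g Fin.zero) ⟩
      1# ∎
      where
      cons-≈ : ∀ {x f} → Pointwise.Pointwise S._≈_ (x ∷ᶠ f) g ⇔ (x S.≈ g Fin.zero × Pointwise.Pointwise S._≈_ f (g ∘ Fin.suc))
      cons-≈ = mk⇔ (λ x∷f≈g → x∷f≈g Fin.zero , x∷f≈g ∘ Fin.suc) (λ { (x≈ , f≈) Fin.zero → x≈ ; (x≈ , f≈) (Fin.suc i) → f≈ i })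

module Matrices (F : CommutativeRing 0ℓ 0ℓ) where
  open CommutativeRing F hiding (zero)
  open Ops F
  open FiniteSums F
  open import Algebra.Properties.Ring ring using (-‿distribˡ-*; -‿distribʳ-*)
  open import Algebra.Properties.AbelianGroup +-abelianGroup using (⁻¹-∙-comm; xyx⁻¹≈y)
  open import Algebra.Solver.Ring.NaturalCoefficients.Default commutativeSemiring
  open import Relation.Binary.Reasoning.Setoid setoid

  matrixSetoid : ℕ → Setoid 0ℓ 0ℓ
  matrixSetoid n = Pointwise.setoid (Pointwise.setoid setoid n) n

  module ≈M {n : ℕ} = Setoid (matrixSetoid n)

  idM-diag : ∀ {n} (i : Fin n) → idM i i ≡ 1#
  idM-diag i with i Fin.≟ i
  ... | yes _  = P.refl
  ... | no i≢i = contradiction P.refl i≢i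

  idM-offdiag : ∀ {n} {i j : Fin n} → i ≢ j → idM i j ≡ 0#
  idM-offdiag {i = i} {j} i≢j with i Fin.≟ j
  ... | yes i≡j = contradiction i≡j i≢j
  ... | no _    = P.refl

  idM-suc : ∀ {n} (i j : Fin n) → idM (Fin.suc i) (Fin.suc j) ≡ idM i j
  idM-suc i j with i Fin.≟ j
  ... | yes _ = P.refl
  ... | no _  = P.refl

  idM-sym : ∀ {n} (i j : Fin n) → idM i j ≡ idM j i
  idM-sym i j with i Fin.≟ j
  ... | yes P.refl = P.sym (idM-diag i)
  ... | no i≢j     = P.sym (idM-offdiag (i≢j ∘ P.sym))

  idM≡𝟙 : ∀ {n} (i j : Fin n) → idM i j ≡ 𝟙 (i Fin.≟ j)
  idM≡𝟙 i j with i Fin.≟ j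
  ... | yes _ = P.refl
  ... | no _  = P.refl

  ΣFin-selectˡ : ∀ n (i : Fin n) (f : Fin n → Carrier) → ΣFin n (λ k → idM i k * f k) ≈ f i
  ΣFin-selectˡ (suc n) Fin.zero f = begin
    1# * f Fin.zero + ΣFin n (λ k → 0# * f (Fin.suc k))  ≈⟨ +-cong (*-identityˡ _) (ΣFin-cong n (λ k → zeroˡ _)) ⟩
    f Fin.zero + ΣFin n (λ _ → 0#)                       ≈⟨ +-congˡ (ΣFin-zero n) ⟩
    f Fin.zero + 0#                                      ≈⟨ +-identityʳ _ ⟩
    f Fin.zero                                           ∎
  ΣFin-selectˡ (suc n) (Fin.suc i) f = begin
    0# * f Fin.zero + ΣFin n (λ k → idM (Fin.suc i) (Fin.suc k) * f (Fin.suc k))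
      ≈⟨ +-cong (zeroˡ _) (ΣFin-cong n (λ k → *-congʳ (reflexive (idM-suc i k)))) ⟩
    0# + ΣFin n (λ k → idM i k * f (Fin.suc k))
      ≈⟨ +-identityˡ _ ⟩
    ΣFin n (λ k → idM i k * f (Fin.suc k))
      ≈⟨ ΣFin-selectˡ n i (f ∘ Fin.suc) ⟩
    f (Fin.suc i) ∎

  ΣFin-selectʳ : ∀ n (i : Fin n) (f : Fin n → Carrier) → ΣFin n (λ k → f k * idM k i) ≈ f i
  ΣFin-selectʳ n i f =
    trans (ΣFin-cong n (λ k → trans (*-comm _ _) (*-congʳ (reflexive (idM-sym k i))))) (ΣFin-selectˡ n i f)

  rowMul : ∀ {n} → Vector Carrier n → Matrix n → Vector Carrier n
  rowMul {n} v A l = ΣFin n (λ k → v k * A k l)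

  rowMul-cong : ∀ {n} {v v′ : Vector Carrier n} {A A′ : Matrix n} →
                (∀ k → v k ≈ v′ k) → A ≈M A′ → ∀ l → rowMul v A l ≈ rowMul v′ A′ l
  rowMul-cong {n} v≈v′ A≈A′ l = ΣFin-cong n (λ k → *-cong (v≈v′ k) (A≈A′ k l))

  rowMul-assoc : ∀ {n} (v : Vector Carrier n) (A B : Matrix n) → ∀ l → rowMul (rowMul v A) B l ≈ rowMul v (mulM A B) l
  rowMul-assoc {n} v A B l = begin
    ΣFin n (λ k → ΣFin n (λ j → v j * A j k) * B k l)    ≈⟨ ΣFin-cong n (λ k → *-distribʳ-ΣFin n (B k l) _) ⟩
    ΣFin n (λ k → ΣFin n (λ j → v j * A j k * B k l))    ≈⟨ ΣFin-comm n n _ ⟩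
    ΣFin n (λ j → ΣFin n (λ k → v j * A j k * B k l))    ≈⟨ ΣFin-cong n (λ j → ΣFin-cong n (λ k → *-assoc _ _ _)) ⟩
    ΣFin n (λ j → ΣFin n (λ k → v j * (A j k * B k l)))  ≈⟨ ΣFin-cong n (λ j → *-distribˡ-ΣFin n (v j) _) ⟨
    ΣFin n (λ j → v j * ΣFin n (λ k → A j k * B k l))    ∎

  rowMul-identityʳ : ∀ {n} (v : Vector Carrier n) → ∀ l → rowMul v idM l ≈ v l
  rowMul-identityʳ {n} v l = ΣFin-selectʳ n l v

  rowMul-unitRow : ∀ {n} (j : Fin n) (A : Matrix n) → ∀ l → rowMul (idM j) A l ≈ A j l
  rowMul-unitRow {n} j A l = ΣFin-selectˡ n j (λ k → A k l)

  mulM-cong : ∀ {n} {A A′ B B′ : Matrix n} → A ≈M A′ → B ≈M B′ → mulM A B ≈M mulM A′ B′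
  mulM-cong A≈A′ B≈B′ i = rowMul-cong (A≈A′ i) B≈B′

  mulM-assoc : ∀ {n} (A B C : Matrix n) → mulM (mulM A B) C ≈M mulM A (mulM B C)
  mulM-assoc A B C i = rowMul-assoc (A i) B C

  mulM-identityˡ : ∀ {n} (A : Matrix n) → mulM idM A ≈M A
  mulM-identityˡ A i = rowMul-unitRow i A

  mulM-identityʳ : ∀ {n} (A : Matrix n) → mulM A idM ≈M A
  mulM-identityʳ A i = rowMul-identityʳ (A i)

  Inverses : ∀ {n} → Matrix n → Matrix n → Set
  Inverses A A′ = (mulM A A′ ≈M idM) × (mulM A′ A ≈M idM)

  Invertible-cong : ∀ {n} {A A′ : Matrix n} → A ≈M A′ → Invertible A → Invertible A′
  Invertible-cong A≈A′ (L , AL≈I , LA≈I) =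
    L , ≈M.trans (mulM-cong (≈M.sym A≈A′) ≈M.refl) AL≈I , ≈M.trans (mulM-cong ≈M.refl (≈M.sym A≈A′)) LA≈I

  Invertible-mulM : ∀ {n} {A B : Matrix n} → Invertible A → Invertible B → Invertible (mulM A B)
  Invertible-mulM {A = A} {B} (A′ , AA′≈I , A′A≈I) (B′ , BB′≈I , B′B≈I) =
    mulM B′ A′ , cancel A A′ B B′ AA′≈I BB′≈I , cancel B′ B A′ A B′B≈I A′A≈I
    where
    cancel : ∀ {n} (A A′ B B′ : Matrix n) → mulM A A′ ≈M idM → mulM B B′ ≈M idM → mulM (mulM A B) (mulM B′ A′) ≈M idM
    cancel A A′ B B′ AA′≈I BB′≈I = ≈M.trans (mulM-assoc A B _) (≈M.trans (mulM-cong ≈M.refl BB′A′≈A′) AA′≈I)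
      where
      BB′A′≈A′ : mulM B (mulM B′ A′) ≈M A′
      BB′A′≈A′ = ≈M.trans (≈M.sym (mulM-assoc B B′ A′)) (≈M.trans (mulM-cong BB′≈I ≈M.refl) (mulM-identityˡ A′))

  Invertible-*ʳ : ∀ {n} {A A′ K : Matrix n} → Inverses A A′ → Invertible (mulM K A) ⇔ Invertible K
  Invertible-*ʳ {A = A} {A′} {K} (AA′≈I , A′A≈I) = mk⇔
    (λ KA-inv → Invertible-cong KAA′≈K (Invertible-mulM KA-inv (A , A′A≈I , AA′≈I)))
    (λ K-inv → Invertible-mulM K-inv (A′ , AA′≈I , A′A≈I))
    where
    KAA′≈K : mulM (mulM K A) A′ ≈M K
    KAA′≈K = ≈M.trans (mulM-assoc K A A′) (≈M.trans (mulM-cong ≈M.refl AA′≈I) (mulM-identityʳ K))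

  Invertible-*ˡ : ∀ {n} {A A′ K : Matrix n} → Inverses A A′ → Invertible (mulM A K) ⇔ Invertible K
  Invertible-*ˡ {A = A} {A′} {K} (AA′≈I , A′A≈I) = mk⇔
    (λ AK-inv → Invertible-cong A′AK≈K (Invertible-mulM (A , A′A≈I , AA′≈I) AK-inv))
    (λ K-inv → Invertible-mulM (A′ , AA′≈I , A′A≈I) K-inv)
    where
    A′AK≈K : mulM A′ (mulM A K) ≈M K
    A′AK≈K = ≈M.trans (≈M.sym (mulM-assoc A′ A K)) (≈M.trans (mulM-cong A′A≈I ≈M.refl) (mulM-identityˡ K))

  rowMul-cancelʳ : ∀ {n} {A A′ : Matrix n} → Inverses A A′ → ∀ {u v} →
                   (∀ l → rowMul u A l ≈ rowMul v A l) → ∀ l → u l ≈ v l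
  rowMul-cancelʳ {A = A} {A′} (AA′≈I , _) {u} {v} uA≈vA l = begin
    u l                             ≈⟨ rowMul-identityʳ u l ⟨
    rowMul u idM l                  ≈⟨ rowMul-cong (λ _ → refl) AA′≈I l ⟨
    rowMul u (mulM A A′) l          ≈⟨ rowMul-assoc u A A′ l ⟨
    rowMul (rowMul u A) A′ l        ≈⟨ rowMul-cong {A = A′} uA≈vA ≈M.refl l ⟩
    rowMul (rowMul v A) A′ l        ≈⟨ rowMul-assoc v A A′ l ⟩
    rowMul v (mulM A A′) l          ≈⟨ rowMul-cong (λ _ → refl) AA′≈I l ⟩
    rowMul v idM l                  ≈⟨ rowMul-identityʳ v l ⟩
    v l                             ∎

  mulMʳ-inverse : ∀ {n} {A A′ : Matrix n} → Inverses A A′ → Inverse (matrixSetoid n) (matrixSetoid n)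
  mulMʳ-inverse {A = A} {A′} (AA′≈I , A′A≈I) = record
    { to        = λ K → mulM K A
    ; from      = λ K → mulM K A′
    ; to-cong   = λ K≈K′ → mulM-cong K≈K′ ≈M.refl
    ; from-cong = λ K≈K′ → mulM-cong K≈K′ ≈M.refl
    ; inverse   = (λ K≈LA′ → ≈M.trans (mulM-cong K≈LA′ ≈M.refl) (cancel A′A≈I))
                , (λ K≈LA → ≈M.trans (mulM-cong K≈LA ≈M.refl) (cancel AA′≈I))
    }
    where
    cancel : ∀ {B B′ L} → mulM B′ B ≈M idM → mulM (mulM L B′) B ≈M L
    cancel {B} {B′} {L} B′B≈I = ≈M.trans (mulM-assoc L B′ B) (≈M.trans (mulM-cong ≈M.refl B′B≈I) (mulM-identityʳ L))

  mulMˡ-inverse : ∀ {n} {A A′ : Matrix n} → Inverses A A′ → Inverse (matrixSetoid n) (matrixSetoid n)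
  mulMˡ-inverse {A = A} {A′} (AA′≈I , A′A≈I) = record
    { to        = mulM A
    ; from      = mulM A′
    ; to-cong   = mulM-cong ≈M.refl
    ; from-cong = mulM-cong ≈M.refl
    ; inverse   = (λ K≈A′L → ≈M.trans (mulM-cong ≈M.refl K≈A′L) (cancel AA′≈I))
                , (λ K≈AL → ≈M.trans (mulM-cong ≈M.refl K≈AL) (cancel A′A≈I))
    }
    where
    cancel : ∀ {B B′ L} → mulM B B′ ≈M idM → mulM B (mulM B′ L) ≈M L
    cancel {B} {B′} {L} BB′≈I = ≈M.trans (≈M.sym (mulM-assoc B B′ L)) (≈M.trans (mulM-cong BB′≈I ≈M.refl) (mulM-identityˡ L))

  zeroRow⇒¬Invertible : ¬ (1# ≈ 0#) → ∀ {n} (K : Matrix n) (i : Fin n) → (∀ l → K i l ≈ 0#) → ¬ Invertible K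
  zeroRow⇒¬Invertible 1≉0 {n} K i Kᵢ≈0 (L , KL≈I , _) = 1≉0 (begin
    1#                               ≡⟨ idM-diag i ⟨
    idM i i                          ≈⟨ KL≈I i i ⟨
    ΣFin n (λ k → K i k * L k i)     ≈⟨ ΣFin-cong n (λ k → trans (*-congʳ (Kᵢ≈0 k)) (zeroˡ _)) ⟩
    ΣFin n (λ _ → 0#)                ≈⟨ ΣFin-zero n ⟩
    0#                               ∎)

  σ-cong : ∀ {n} {K K′ : Matrix n} → K ≈M K′ → σ K ≈ σ K′
  σ-cong {n} K≈K′ = ΣFin-cong n (λ i → ΣFin-cong n (K≈K′ i))

  σ-mulM : ∀ {n} (A K : Matrix n) → σ (mulM A K) ≈ ΣFin n (λ k → ΣFin n (λ i → A i k) * ΣFin n (K k))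
  σ-mulM {n} A K = begin
    ΣFin n (λ i → ΣFin n (λ j → ΣFin n (λ k → A i k * K k j)))   ≈⟨ ΣFin-cong n (λ i → ΣFin-comm n n _) ⟩
    ΣFin n (λ i → ΣFin n (λ k → ΣFin n (λ j → A i k * K k j)))   ≈⟨ ΣFin-comm n n _ ⟩
    ΣFin n (λ k → ΣFin n (λ i → ΣFin n (λ j → A i k * K k j)))   ≈⟨ ΣFin-cong n (λ k → ΣFin-cong n (λ i → *-distribˡ-ΣFin n (A i k) (K k))) ⟨
    ΣFin n (λ k → ΣFin n (λ i → A i k * ΣFin n (K k)))           ≈⟨ ΣFin-cong n (λ k → *-distribʳ-ΣFin n (ΣFin n (K k)) _) ⟨
    ΣFin n (λ k → ΣFin n (λ i → A i k) * ΣFin n (K k))           ∎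

  rowUpdate : ∀ {n} → Fin n → Vector Carrier n → Matrix n
  rowUpdate j a i k = idM i k + idM j i * a k

  rowMul-rowUpdate : ∀ {n} (j : Fin n) (v a : Vector Carrier n) → ∀ l → rowMul v (rowUpdate j a) l ≈ v l + v j * a l
  rowMul-rowUpdate {n} j v a l = begin
    ΣFin n (λ k → v k * (idM k l + idM j k * a l))
      ≈⟨ ΣFin-cong n (λ k → expand (v k) (idM k l) (idM j k) (a l)) ⟩
    ΣFin n (λ k → v k * idM k l + idM j k * (v k * a l))
      ≈⟨ ΣFin-distrib-+ n _ _ ⟩
    ΣFin n (λ k → v k * idM k l) + ΣFin n (λ k → idM j k * (v k * a l))
      ≈⟨ +-cong (ΣFin-selectʳ n l v) (ΣFin-selectˡ n j (λ k → v k * a l)) ⟩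
    v l + v j * a l ∎
    where
    expand : ∀ x d e y → x * (d + e * y) ≈ x * d + e * (x * y)
    expand = solve 4 (λ x d e y → x :* (d :+ e :* y) := x :* d :+ e :* (x :* y)) refl

  mulM-rowUpdate : ∀ {n} (j : Fin n) (a b : Vector Carrier n) →
                   mulM (rowUpdate j a) (rowUpdate j b) ≈M rowUpdate j (λ l → (a l + b l) + a j * b l)
  mulM-rowUpdate j a b i l = begin
    rowMul (rowUpdate j a i) (rowUpdate j b) l
      ≈⟨ rowMul-rowUpdate j (rowUpdate j a i) b l ⟩
    (idM i l + idM j i * a l) + (idM i j + idM j i * a j) * b l
      ≡⟨ P.cong (λ e → (idM i l + idM j i * a l) + (e + idM j i * a j) * b l) (idM-sym i j) ⟩
    (idM i l + idM j i * a l) + (idM j i + idM j i * a j) * b l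
      ≈⟨ regroup (idM i l) (idM j i) (a l) (b l) (a j) ⟩
    idM i l + idM j i * ((a l + b l) + a j * b l) ∎
    where
    regroup : ∀ d e x y z → (d + e * x) + (e + e * z) * y ≈ d + e * ((x + y) + z * y)
    regroup = solve 5 (λ d e x y z → (d :+ e :* x) :+ (e :+ e :* z) :* y := d :+ e :* ((x :+ y) :+ z :* y)) refl

  rowUpdate-≈idM : ∀ {n} (j : Fin n) {c : Vector Carrier n} → (∀ l → c l ≈ 0#) → rowUpdate j c ≈M idM
  rowUpdate-≈idM j c≈0 i k = trans (+-congˡ (trans (*-congˡ (c≈0 k)) (zeroʳ _))) (+-identityʳ _)

  rowUpdate-inverses : ∀ {n} (j : Fin n) (a : Vector Carrier n) {u : Carrier} → (1# + a j) * u ≈ 1# →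
                       Inverses (rowUpdate j a) (rowUpdate j (λ l → - (u * a l)))
  rowUpdate-inverses j a {u} [1+aⱼ]u≈1 =
      ≈M.trans (mulM-rowUpdate j a _) (rowUpdate-≈idM j (λ l → begin
        (a l + - (u * a l)) + a j * - (u * a l)   ≈⟨ +-congˡ (sym (-‿distribʳ-* (a j) _)) ⟩
        (a l + - (u * a l)) + - (a j * (u * a l)) ≈⟨ +-assoc _ _ _ ⟩
        a l + (- (u * a l) + - (a j * (u * a l))) ≈⟨ cancels (a l) ⟩
        0#                                        ∎))
    , ≈M.trans (mulM-rowUpdate j _ a) (rowUpdate-≈idM j (λ l → begin
        (- (u * a l) + a l) + - (u * a j) * a l   ≈⟨ +-congʳ (+-comm _ _) ⟩
        (a l + - (u * a l)) + - (u * a j) * a l   ≈⟨ +-congˡ (sym (-‿distribˡ-* _ _)) ⟩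
        (a l + - (u * a l)) + - (u * a j * a l)   ≈⟨ +-congˡ (-‿cong (*-commute u (a j) (a l))) ⟩
        (a l + - (u * a l)) + - (a j * (u * a l)) ≈⟨ +-assoc _ _ _ ⟩
        a l + (- (u * a l) + - (a j * (u * a l))) ≈⟨ cancels (a l) ⟩
        0#                                        ∎))
    where
    *-commute : ∀ x y z → x * y * z ≈ y * (x * z)
    *-commute = solve 3 (λ x y z → x :* y :* z := y :* (x :* z)) refl

    cancels : ∀ x → x + (- (u * x) + - (a j * (u * x))) ≈ 0#
    cancels x = begin
      x + (- (u * x) + - (a j * (u * x)))  ≈⟨ +-congˡ (⁻¹-∙-comm _ _) ⟩
      x + - (u * x + a j * (u * x))        ≈⟨ +-congˡ (-‿cong (sym (trans (distribʳ (u * x) 1# (a j)) (+-congʳ (*-identityˡ _))))) ⟩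
      x + - ((1# + a j) * (u * x))         ≈⟨ +-congˡ (-‿cong (sym (*-assoc _ u x))) ⟩
      x + - ((1# + a j) * u * x)           ≈⟨ +-congˡ (-‿cong (trans (*-congʳ [1+aⱼ]u≈1) (*-identityˡ x))) ⟩
      x + - x                              ≈⟨ -‿inverseʳ x ⟩
      0#                                   ∎

  rowUpdate-unitRow : ∀ {n} (j : Fin n) (a : Vector Carrier n) → ∀ l → rowMul (idM j) (rowUpdate j a) l ≈ idM j l + a l
  rowUpdate-unitRow j a l = trans (rowMul-unitRow j (rowUpdate j a) l) (+-congˡ (trans (*-congʳ (reflexive (idM-diag j))) (*-identityˡ _)))

  sumToRow : ∀ {n} → Fin n → Matrix n
  sumToRow j = rowUpdate j (λ k → idM j k + - 1#)

  sumToRow-inverses : ∀ {n} (j : Fin n) → Inverses (sumToRow j) (rowUpdate j (λ k → - (1# * (idM j k + - 1#))))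
  sumToRow-inverses j = rowUpdate-inverses j _
    (trans (*-identityʳ _) (trans (+-congˡ (+-congʳ (reflexive (idM-diag j)))) (trans (sym (+-assoc 1# 1# _)) (xyx⁻¹≈y 1# 1#))))

  -- The columns of sumToRow j sum to eⱼ, so it collapses σ onto row j.
  σ-sumToRow : ∀ {n} (j : Fin n) (K : Matrix n) → σ (mulM (sumToRow j) K) ≈ ΣFin n (K j)
  σ-sumToRow {n} j K = begin
    σ (mulM (sumToRow j) K)                                         ≈⟨ σ-mulM (sumToRow j) K ⟩
    ΣFin n (λ k → ΣFin n (λ i → sumToRow j i k) * ΣFin n (K k))     ≈⟨ ΣFin-cong n (λ k → *-congʳ (columnSum k)) ⟩
    ΣFin n (λ k → idM j k * ΣFin n (K k))                           ≈⟨ ΣFin-selectˡ n j (λ k → ΣFin n (K k)) ⟩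
    ΣFin n (K j)                                                    ∎
    where
    columnSum : ∀ k → ΣFin n (λ i → sumToRow j i k) ≈ idM j k
    columnSum k = begin
      ΣFin n (λ i → idM i k + idM j i * (idM j k + - 1#))
        ≈⟨ ΣFin-distrib-+ n (λ i → idM i k) (λ i → idM j i * (idM j k + - 1#)) ⟩
      ΣFin n (λ i → idM i k) + ΣFin n (λ i → idM j i * (idM j k + - 1#))
        ≈⟨ +-cong (trans (ΣFin-cong n (λ i → sym (*-identityˡ _))) (ΣFin-selectʳ n k (λ _ → 1#)))
                  (ΣFin-selectˡ n j (λ _ → idM j k + - 1#)) ⟩
      1# + (idM j k + - 1#)
        ≈⟨ trans (sym (+-assoc 1# _ _)) (xyx⁻¹≈y 1# _) ⟩
      idM j k ∎

  colMul : ∀ {n} → Matrix n → Vector Carrier n → Vector Carrier n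
  colMul {n} M v i = ΣFin n (λ k → M i k * v k)

  colMul-assoc : ∀ {n} (M N : Matrix n) (v : Vector Carrier n) → ∀ i → colMul M (colMul N v) i ≈ colMul (mulM M N) v i
  colMul-assoc M N v i = sym (mulM-assoc M N (λ k _ → v k) i i)

  colMul-neg : ∀ {n} (M : Matrix n) (v : Vector Carrier n) → ∀ i → colMul M (λ k → - v k) i ≈ - colMul M v i
  colMul-neg {n} M v i = trans (ΣFin-cong n (λ k → sym (-‿distribʳ-* (M i k) (v k)))) (ΣFin-neg n _)

  block : ∀ {m} → Vector Carrier m → Matrix m → Matrix (suc m)
  block t M = idM Fin.zero ∷ᶠ (λ i → t i ∷ᶠ M i)

  block-cong : ∀ {m} {t t′ : Vector Carrier m} {M M′ : Matrix m} →
               (∀ i → t i ≈ t′ i) → M ≈M M′ → block t M ≈M block t′ M′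
  block-cong t≈t′ M≈M′ Fin.zero       l           = refl
  block-cong t≈t′ M≈M′ (Fin.suc i)    Fin.zero    = t≈t′ i
  block-cong t≈t′ M≈M′ (Fin.suc i)    (Fin.suc j) = M≈M′ i j

  block-≈idM : ∀ {m} {t : Vector Carrier m} → (∀ i → t i ≈ 0#) → block t idM ≈M idM
  block-≈idM t≈0 Fin.zero    l           = refl
  block-≈idM t≈0 (Fin.suc i) Fin.zero    = t≈0 i
  block-≈idM t≈0 (Fin.suc i) (Fin.suc j) = reflexive (P.sym (idM-suc i j))

  mulM-block : ∀ {m} (t s : Vector Carrier m) (M N : Matrix m) →
               mulM (block t M) (block s N) ≈M block (λ i → t i + colMul M s i) (mulM M N)
  mulM-block {m} t s M N Fin.zero    l           = ΣFin-selectˡ (suc m) Fin.zero (λ k → block s N k l)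
  mulM-block {m} t s M N (Fin.suc i) Fin.zero    = +-congʳ (*-identityʳ _)
  mulM-block {m} t s M N (Fin.suc i) (Fin.suc j) = trans (+-congʳ (zeroʳ _)) (+-identityˡ _)

  Invertible-block⁺ : ∀ {m} (t : Vector Carrier m) {M : Matrix m} → Invertible M → Invertible (block t M)
  Invertible-block⁺ {m} t {M} (N , MN≈I , NM≈I) = block s N
    , ≈M.trans (mulM-block t s M N) (≈M.trans (block-cong t+Ms≈0 MN≈I) (block-≈idM (λ _ → refl)))
    , ≈M.trans (mulM-block s t N M) (≈M.trans (block-cong (λ i → -‿inverseˡ _) NM≈I) (block-≈idM (λ _ → refl)))
    where
    s : Vector Carrier m
    s i = - colMul N t i
    t+Ms≈0 : ∀ i → t i + colMul M s i ≈ 0#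
    t+Ms≈0 i = begin
      t i + colMul M s i                   ≈⟨ +-congˡ (colMul-neg M (colMul N t) i) ⟩
      t i + - colMul M (colMul N t) i      ≈⟨ +-congˡ (-‿cong (colMul-assoc M N t i)) ⟩
      t i + - colMul (mulM M N) t i        ≈⟨ +-congˡ (-‿cong (ΣFin-cong m (λ k → *-congʳ (MN≈I i k)))) ⟩
      t i + - colMul idM t i               ≈⟨ +-congˡ (-‿cong (ΣFin-selectˡ m i t)) ⟩
      t i + - t i                          ≈⟨ -‿inverseʳ (t i) ⟩
      0#                                   ∎

  -- Row 0 of K·L = I forces L₀ⱼ = 0 for j > 0, so the lower-right block of L inverts M.
  Invertible-block⁻ : ∀ {m} (t : Vector Carrier m) {M : Matrix m} → Invertible (block t M) → Invertible M
  Invertible-block⁻ {m} t {M} (L , KL≈I , LK≈I) = N , MN≈I , NM≈I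
    where
    N : Matrix m
    N i j = L (Fin.suc i) (Fin.suc j)
    L₀≈0 : ∀ j → L Fin.zero (Fin.suc j) ≈ 0#
    L₀≈0 j = trans (sym (ΣFin-selectˡ (suc m) Fin.zero (λ k → L k (Fin.suc j)))) (KL≈I Fin.zero (Fin.suc j))
    NM≈I : mulM N M ≈M idM
    NM≈I i j = begin
      ΣFin m (λ k → N i k * M k j)                                     ≈⟨ +-identityˡ _ ⟨
      0# + ΣFin m (λ k → N i k * M k j)                                ≈⟨ +-congʳ (zeroʳ _) ⟨
      L (Fin.suc i) Fin.zero * 0# + ΣFin m (λ k → N i k * M k j)       ≈⟨ LK≈I (Fin.suc i) (Fin.suc j) ⟩
      idM (Fin.suc i) (Fin.suc j)                                      ≡⟨ idM-suc i j ⟩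
      idM i j                                                          ∎
    MN≈I : mulM M N ≈M idM
    MN≈I i j = begin
      ΣFin m (λ k → M i k * N k j)                                     ≈⟨ +-identityˡ _ ⟨
      0# + ΣFin m (λ k → M i k * N k j)                                ≈⟨ +-congʳ (trans (*-congˡ (L₀≈0 j)) (zeroʳ _)) ⟨
      t i * L Fin.zero (Fin.suc j) + ΣFin m (λ k → M i k * N k j)      ≈⟨ KL≈I (Fin.suc i) (Fin.suc j) ⟩
      idM (Fin.suc i) (Fin.suc j)                                      ≡⟨ idM-suc i j ⟩
      idM i j                                                          ∎

  Invertible-block : ∀ {m} (t : Vector Carrier m) (M : Matrix m) → Invertible (block t M) ⇔ Invertible M
  Invertible-block t M = mk⇔ (Invertible-block⁻ t) (Invertible-block⁺ t)

module RootsOfUnity (R : CommutativeRing 0ℓ 0ℓ) (R-field : Ops.IsField R) where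
  open CommutativeRing R hiding (zero)
  open Ops R
  open Ops.IsField R-field
  open FiniteSums R
  open import Algebra.Properties.Group +-group using (∙-cancelˡ)
  open import Relation.Binary.Reasoning.Setoid setoid

  fixedBy≉1⇒≈0 : ∀ {x y} → ¬ (x ≈ 1#) → x * y ≈ y → y ≈ 0#
  fixedBy≉1⇒≈0 {x} {y} x≉1 xy≈y = begin
    y                     ≈⟨ *-identityˡ y ⟨
    1# * y                ≈⟨ *-congʳ (trans (*-comm _ _) dv≈1) ⟨
    (v * d) * y           ≈⟨ *-assoc v d y ⟩
    v * (d * y)           ≈⟨ *-congˡ dy≈0 ⟩
    v * 0#                ≈⟨ zeroʳ v ⟩
    0#                    ∎
    where
    d = x + - 1#
    d≉0 : ¬ (d ≈ 0#)
    d≉0 d≈0 = x≉1 (begin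
      x                   ≈⟨ +-identityʳ x ⟨
      x + 0#              ≈⟨ +-congˡ (-‿inverseˡ 1#) ⟨
      x + (- 1# + 1#)     ≈⟨ +-assoc x _ _ ⟨
      d + 1#              ≈⟨ +-congʳ d≈0 ⟩
      0# + 1#             ≈⟨ +-identityˡ 1# ⟩
      1#                  ∎)
    v = proj₁ (inverse d d≉0)
    dv≈1 = proj₂ (inverse d d≉0)
    dy≈0 : d * y ≈ 0#
    dy≈0 = begin
      (x + - 1#) * y      ≈⟨ distribʳ y x (- 1#) ⟩
      x * y + - 1# * y    ≈⟨ +-cong xy≈y (sym (-‿distribˡ-* 1# y)) ⟩
      y + - (1# * y)      ≈⟨ +-congˡ (-‿cong (*-identityˡ y)) ⟩
      y + - y             ≈⟨ -‿inverseʳ y ⟩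
      0#                  ∎
      where open import Algebra.Properties.Ring ring using (-‿distribˡ-*)

  -- Telescoping: 1 + ω·G and G + ωᴺ both expand the sum of ω⁰, …, ωᴺ.
  ΣFin-powers≈0 : ∀ N {ω} → pow ω N ≈ 1# → ¬ (ω ≈ 1#) → ΣFin N (λ i → pow ω (toℕ i)) ≈ 0#
  ΣFin-powers≈0 N {ω} ωᴺ≈1 ω≉1 = fixedBy≉1⇒≈0 ω≉1 (∙-cancelˡ 1# _ _ (begin
    1# + ω * G                                         ≈⟨ +-congˡ (*-distribˡ-ΣFin N ω _) ⟩
    ΣFin (suc N) (λ i → pow ω (toℕ i))                 ≈⟨ ΣFin-init-last N (λ i → pow ω (toℕ i)) ⟩
    ΣFin N (λ i → pow ω (toℕ (Fin.inject₁ i))) + pow ω (toℕ (Fin.fromℕ N))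
      ≈⟨ +-cong (ΣFin-cong N (λ i → reflexive (P.cong (pow ω) (toℕ-inject₁ i)))) (reflexive (P.cong (pow ω) (toℕ-fromℕ N))) ⟩
    G + pow ω N                                        ≈⟨ trans (+-congˡ ωᴺ≈1) (+-comm G 1#) ⟩
    1# + G                                             ∎))
    where
    G = ΣFin N (λ i → pow ω (toℕ i))

module GLOrder where
  open import Data.Nat using (_+_; _*_; _∸_)
  open import Data.Nat.Properties using (m+n∸n≡m; ^-distribˡ-+-*; *-zeroʳ)
  open import Data.Nat.Combinatorics using (_C_; nC1≡n; nCk+nC[k+1]≡[n+1]C[k+1])
  open import Data.Nat.Tactic.RingSolver using (solve-∀)
  open P using (cong; cong₂; sym; trans)
  open P.≡-Reasoning

  -- |GL_(m+1)(F_q)| = (q^(m+1) − 1)·q^m·|GL_m(F_q)|: the first row is any nonzero vector,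
  -- and each nonzero vector is the first row of q^m·|GL_m(F_q)| invertible matrices.
  glOrder : ℕ → ℕ → ℕ
  glOrder q zero    = 1
  glOrder q (suc m) = (q ^ suc m ∸ 1) * (q ^ m * glOrder q m)

  [q-1][j]q+1≡q^j : ∀ a j → a * qint (suc a) j + 1 ≡ suc a ^ j
  [q-1][j]q+1≡q^j a zero    = cong (_+ 1) (*-zeroʳ a)
  [q-1][j]q+1≡q^j a (suc j) = begin
    a * (1 + suc a * qint (suc a) j) + 1   ≡⟨ regroup a (qint (suc a) j) ⟩
    suc a * (a * qint (suc a) j + 1)       ≡⟨ cong (suc a *_) ([q-1][j]q+1≡q^j a j) ⟩
    suc a * suc a ^ j                      ∎
    where
    regroup : ∀ a x → a * (1 + (1 + a) * x) + 1 ≡ (1 + a) * (a * x + 1)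
    regroup = solve-∀

  q^j∸1≡[q-1][j]q : ∀ a j → suc a ^ j ∸ 1 ≡ a * qint (suc a) j
  q^j∸1≡[q-1][j]q a j = trans (cong (_∸ 1) (sym ([q-1][j]q+1≡q^j a j))) (m+n∸n≡m (a * qint (suc a) j) 1)

  [m+2]C2 : ∀ m → suc (suc m) C 2 ≡ suc m + suc m C 2
  [m+2]C2 m = trans (sym (nCk+nC[k+1]≡[n+1]C[k+1] (suc m) 1)) (cong (_+ (suc m C 2)) (nC1≡n (suc m)))

  q^m*glOrder≡rhsNat : ∀ {q} → 1 ≤ q → ∀ m → q ^ m * glOrder q m ≡ rhsNat q (suc m)
  q^m*glOrder≡rhsNat {suc a} _   zero    = P.refl
  q^m*glOrder≡rhsNat {suc a} q≥1 (suc m) = begin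
    q ^ suc m * ((q ^ suc m ∸ 1) * (q ^ m * glOrder q m))
      ≡⟨ cong₂ (λ x y → q ^ suc m * (x * y)) (q^j∸1≡[q-1][j]q a (suc m)) (q^m*glOrder≡rhsNat q≥1 m) ⟩
    q ^ suc m * ((a * qint q (suc m)) * (a ^ m * q ^ (suc m C 2) * qfact q m))
      ≡⟨ regroup a (a ^ m) (q ^ suc m) (q ^ (suc m C 2)) (qint q (suc m)) (qfact q m) ⟩
    (a * a ^ m) * (q ^ suc m * q ^ (suc m C 2)) * (qint q (suc m) * qfact q m)
      ≡⟨ cong (λ e → (a * a ^ m) * e * (qint q (suc m) * qfact q m))
              (trans (sym (^-distribˡ-+-* q (suc m) (suc m C 2))) (cong (q ^_) (sym ([m+2]C2 m)))) ⟩
    rhsNat q (suc (suc m)) ∎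
    where
    q = suc a
    regroup : ∀ a b c d e f → c * ((a * e) * (b * d * f)) ≡ (a * b) * (c * d) * (e * f)
    regroup = solve-∀

module FieldEnumeration (F : CommutativeRing 0ℓ 0ℓ) (N : ℕ)
  (φ : CommutativeRing.Carrier F → Fin N) (ψ : Fin N → CommutativeRing.Carrier F)
  (bij : IsBijection F N φ ψ) where
  open CommutativeRing F using (Carrier; _≈_; isEquivalence; refl; sym; trans; reflexive)
  open IsBijection bij

  _≟_ : ∀ x y → Dec (x ≈ y)
  x ≟ y = Dec.map′ (λ φx≡φy → trans (sym (ψφ x)) (trans (reflexive (P.cong ψ φx≡φy)) (ψφ y))) φ-cong (φ x Fin.≟ φ y)

  decSetoid : DecSetoid 0ℓ 0ℓ
  decSetoid = record { isDecEquivalence = record { isEquivalence = isEquivalence ; _≟_ = _≟_ } }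

  vectorDecSetoid : ℕ → DecSetoid 0ℓ 0ℓ
  vectorDecSetoid = Pointwise.decSetoid decSetoid

  matrixDecSetoid : ℕ → DecSetoid 0ℓ 0ℓ
  matrixDecSetoid n = Pointwise.decSetoid (vectorDecSetoid n) n

  module _ (R : CommutativeRing 0ℓ 0ℓ) where
    private module R = CommutativeRing R
    open R using () renaming (_≈_ to _≈ᴿ_; 1# to 1ᴿ)
    open Ops R using (ΣList; ΣFin)
    open FiniteSums R
    open Enumerations R

    ΣList-elements : (f : Carrier → CommutativeRing.Carrier R) → ΣList (map ψ (allFin N)) f ≈ᴿ ΣFin N (f ∘ ψ)
    ΣList-elements f = R.trans (ΣList-map ψ (allFin N) f) (ΣList-tabulate N (λ i → i) (f ∘ ψ))

    enumeration : Enumeration decSetoid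
    enumeration = record { elements = map ψ (allFin N) ; counts-once = λ y → R.trans (ΣList-elements _) (counts-once-ψ y) }
      where
      ψi≈y⇔i≡φy : ∀ {i y} → ψ i ≈ y ⇔ i ≡ φ y
      ψi≈y⇔i≡φy {i} {y} = mk⇔ (λ ψi≈y → P.trans (P.sym (φψ i)) (φ-cong ψi≈y)) (λ i≡φy → trans (reflexive (P.cong ψ i≡φy)) (ψφ y))
      counts-once-ψ : ∀ y → ΣFin N (λ i → 𝟙 (ψ i ≟ y)) ≈ᴿ 1ᴿ
      counts-once-ψ y = begin
        ΣFin N (λ i → 𝟙 (ψ i ≟ y))           ≈⟨ ΣFin-cong N (λ i → 𝟙-cong ψi≈y⇔i≡φy (ψ i ≟ y) (i Fin.≟ φ y)) ⟩
        ΣFin N (λ i → 𝟙 (i Fin.≟ φ y))       ≈⟨ ΣFin-cong N (λ i → R.reflexive (P.sym (Matrices.idM≡𝟙 R i (φ y)))) ⟩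
        ΣFin N (λ i → Ops.idM R i (φ y))     ≈⟨ ΣFin-cong N (λ i → R.sym (R.*-identityˡ _)) ⟩
        ΣFin N (λ i → 1ᴿ R.* Ops.idM R i (φ y)) ≈⟨ Matrices.ΣFin-selectʳ R N (φ y) (λ _ → 1ᴿ) ⟩
        1ᴿ                                    ∎
        where open import Relation.Binary.Reasoning.Setoid R.setoid

    vectorEnumeration : ∀ m → Enumeration (vectorDecSetoid m)
    vectorEnumeration = vectors enumeration

    matrixEnumeration : ∀ n → Enumeration (matrixDecSetoid n)
    matrixEnumeration n = vectors (vectorEnumeration n) n

module RowFibres (F : CommutativeRing 0ℓ 0ℓ) (F-field : Ops.IsField F) (N : ℕ)
  (φ : CommutativeRing.Carrier F → Fin N) (ψ : Fin N → CommutativeRing.Carrier F)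
  (bij : IsBijection F N φ ψ) (R : CommutativeRing 0ℓ 0ℓ) where
  open CommutativeRing R hiding (zero)
  open Ops R using (ΣList; fromℕ)
  open FiniteSums R
  open Enumerations R
  open FieldEnumeration F N φ ψ bij
  open GLOrder using (glOrder)
  open Ops F using (Matrix; mulM; idM; Invertible; _≈M_)
  private
    module F = CommutativeRing F
    module M = Matrices F
  open M using (rowMul; block)
  open import Algebra.Properties.Ring ring using (-0#≈0#; -‿distribˡ-*)
  open import Data.List.Properties using (length-map; length-tabulate)
  open import Relation.Binary.Reasoning.Setoid setoid

  _≟ᵥ_ : ∀ {m} (u v : Vector F.Carrier m) → Dec (∀ l → u l F.≈ v l)
  _≟ᵥ_ {m} = DecSetoid._≟_ (vectorDecSetoid m)

  vecs : ∀ m → List (Vector F.Carrier m)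
  vecs m = elements (vectorEnumeration R m)

  mats : ∀ n → List (Matrix n)
  mats n = elements (matrixEnumeration R n)

  0ᵥ : ∀ {m} → Vector F.Carrier m
  0ᵥ _ = F.0#

  ΣList-vecs-const : ∀ m c → ΣList (vecs m) (λ _ → c) ≈ fromℕ (N ^ m) * c
  ΣList-vecs-const m c = trans (ΣList-allFuns-const (map ψ (allFin N)) m c)
    (reflexive (P.cong (λ k → fromℕ (k ^ m) * c) (P.trans (length-map ψ (allFin N)) (length-tabulate (λ i → i)))))

  module _ {m : ℕ} (inv? : (K : Matrix (suc m)) → Dec (Invertible K)) where

    𝟙GL : Matrix (suc m) → Carrier
    𝟙GL K = 𝟙 (inv? K)

    𝟙GL-cong : ∀ {K K′ : Matrix (suc m)} → K ≈M K′ → 𝟙GL K ≈ 𝟙GL K′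
    𝟙GL-cong {K} {K′} K≈K′ =
      𝟙-cong (mk⇔ (M.Invertible-cong {A = K} K≈K′) (M.Invertible-cong {A = K′} (M.≈M.sym {x = K} K≈K′))) (inv? K) (inv? K′)

    rowFibre : Vector F.Carrier (suc m) → Carrier
    rowFibre r = ΣList (mats (suc m)) (λ K → 𝟙GL K * 𝟙 (K Fin.zero ≟ᵥ r))

    firstRow-cong : ∀ {K K′ : Matrix (suc m)} {r r′ : Vector F.Carrier (suc m)} → K ≈M K′ → (∀ l → r l F.≈ r′ l) →
                    (∀ l → K Fin.zero l F.≈ r l) ⇔ (∀ l → K′ Fin.zero l F.≈ r′ l)
    firstRow-cong K≈K′ r≈r′ = mk⇔ (λ K₀≈r l → F.trans (F.sym (K≈K′ Fin.zero l)) (F.trans (K₀≈r l) (r≈r′ l)))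
                                  (λ K′₀≈r′ l → F.trans (K≈K′ Fin.zero l) (F.trans (K′₀≈r′ l) (F.sym (r≈r′ l))))

    rowFibre-summand-cong : ∀ {K K′ : Matrix (suc m)} {r r′ : Vector F.Carrier (suc m)} → K ≈M K′ → (∀ l → r l F.≈ r′ l) →
                            𝟙GL K * 𝟙 (K Fin.zero ≟ᵥ r) ≈ 𝟙GL K′ * 𝟙 (K′ Fin.zero ≟ᵥ r′)
    rowFibre-summand-cong {K} {K′} {r} {r′} K≈K′ r≈r′ =
      *-cong (𝟙GL-cong K≈K′) (𝟙-cong (firstRow-cong {K} {K′} {r} {r′} K≈K′ r≈r′) (K Fin.zero ≟ᵥ r) (K′ Fin.zero ≟ᵥ r′))

    rowFibre-cong : ∀ {r r′ : Vector F.Carrier (suc m)} → (∀ l → r l F.≈ r′ l) → rowFibre r ≈ rowFibre r′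
    rowFibre-cong {r} {r′} r≈r′ = ΣList-cong (mats (suc m)) (λ K → rowFibre-summand-cong {K} {K} {r} {r′} M.≈M.refl r≈r′)

    rowFibre-zero : ∀ {r : Vector F.Carrier (suc m)} → (∀ l → r l F.≈ F.0#) → rowFibre r ≈ 0#
    rowFibre-zero {r} r≈0 = trans (ΣList-cong (mats (suc m)) vanishes) (ΣList-zero (mats (suc m)))
      where
      vanishes : ∀ K → 𝟙GL K * 𝟙 (K Fin.zero ≟ᵥ r) ≈ 0#
      vanishes K with K Fin.zero ≟ᵥ r
      ... | yes K₀≈r = trans (*-congʳ (𝟙-no (M.zeroRow⇒¬Invertible (Ops.IsField.1≉0 F-field) K Fin.zero
                                              (λ l → F.trans (K₀≈r l) (r≈0 l))) (inv? K)))
                             (zeroˡ _)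
      ... | no _     = zeroʳ _

    rowFibre-rowMul : ∀ {A A′ : Matrix (suc m)} → M.Inverses A A′ → ∀ r → rowFibre (rowMul r A) ≈ rowFibre r
    rowFibre-rowMul {A} {A′} A⁻¹ r = begin
      rowFibre (rowMul r A)
        ≈⟨ ΣList-reindex (matrixEnumeration R (suc m)) (matrixEnumeration R (suc m)) (M.mulMʳ-inverse {A = A} {A′} A⁻¹)
             (λ {K} {K′} K≈K′ → rowFibre-summand-cong {K} {K′} {rowMul r A} K≈K′ (λ _ → F.refl)) ⟩
      ΣList (mats (suc m)) (λ K → 𝟙GL (mulM K A) * 𝟙 (rowMul (K Fin.zero) A ≟ᵥ rowMul r A))
        ≈⟨ ΣList-cong (mats (suc m)) (λ K → *-cong (𝟙-cong (M.Invertible-*ʳ {A = A} {A′} {K} A⁻¹) (inv? (mulM K A)) (inv? K))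
             (𝟙-cong (mk⇔ (M.rowMul-cancelʳ {A = A} {A′} A⁻¹) (λ K₀≈r → M.rowMul-cong {A = A} K₀≈r M.≈M.refl))
                     (rowMul (K Fin.zero) A ≟ᵥ rowMul r A) (K Fin.zero ≟ᵥ r))) ⟩
      rowFibre r ∎

    -- r = eⱼ · rowUpdate j (r − eⱼ), and that matrix is invertible because its (j, j) entry is r j.
    rowFibre-orbit : ∀ {r : Vector F.Carrier (suc m)} j → ¬ (r j F.≈ F.0#) → rowFibre r ≈ rowFibre (idM j)
    rowFibre-orbit {r} j rⱼ≉0 = begin
      rowFibre r                              ≈⟨ rowFibre-cong eⱼA≈r ⟨
      rowFibre (rowMul (idM j) A)             ≈⟨ rowFibre-rowMul {A = A} {A′} (M.rowUpdate-inverses j a [1+aⱼ]u≈1) (idM j) ⟩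
      rowFibre (idM j)                        ∎
      where
      open import Algebra.Properties.AbelianGroup F.+-abelianGroup using (xyx⁻¹≈y)
      u = proj₁ (Ops.IsField.inverse F-field (r j) rⱼ≉0)
      a : Vector F.Carrier (suc m)
      a l = r l F.+ F.- idM j l
      A = M.rowUpdate j a
      A′ = M.rowUpdate j (λ l → F.- (u F.* a l))
      d+[x-d]≈x : ∀ d x → d F.+ (x F.+ F.- d) F.≈ x
      d+[x-d]≈x d x = F.trans (F.sym (F.+-assoc d x (F.- d))) (xyx⁻¹≈y d x)
      [1+aⱼ]u≈1 : (F.1# F.+ a j) F.* u F.≈ F.1#
      [1+aⱼ]u≈1 = F.trans (F.*-congʳ (F.trans (F.+-congˡ (F.+-congˡ (F.-‿cong (F.reflexive (M.idM-diag j)))))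
                                               (d+[x-d]≈x F.1# (r j))))
                          (proj₂ (Ops.IsField.inverse F-field (r j) rⱼ≉0))
      eⱼA≈r : ∀ l → rowMul (idM j) A l F.≈ r l
      eⱼA≈r l = F.trans (M.rowUpdate-unitRow j a l) (d+[x-d]≈x (idM j l) (r l))

    -- Any two unit rows are linked through e₀ + eⱼ, which is nonzero in both coordinates.
    rowFibre-unitRow : ∀ j → rowFibre (idM j) ≈ rowFibre (idM Fin.zero)
    rowFibre-unitRow j = linked (j Fin.≟ Fin.zero)
      where
      1≉0 = Ops.IsField.1≉0 F-field
      w : Vector F.Carrier (suc m)
      w l = idM Fin.zero l F.+ idM j l
      linked : Dec (j ≡ Fin.zero) → rowFibre (idM j) ≈ rowFibre (idM Fin.zero)
      linked (yes P.refl) = refl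
      linked (no j≢0)     = trans (sym (rowFibre-orbit {w} j wⱼ≉0)) (rowFibre-orbit {w} Fin.zero w₀≉0)
        where
        wⱼ≉0 : ¬ (w j F.≈ F.0#)
        wⱼ≉0 wⱼ≈0 = 1≉0 (F.trans (F.sym (F.trans (F.+-cong (F.reflexive (M.idM-offdiag (j≢0 ∘ P.sym))) (F.reflexive (M.idM-diag j)))
                                                   (F.+-identityˡ F.1#)))
                                 wⱼ≈0)
        w₀≉0 : ¬ (w Fin.zero F.≈ F.0#)
        w₀≉0 w₀≈0 = 1≉0 (F.trans (F.sym (F.trans (F.+-congˡ (F.reflexive (M.idM-offdiag j≢0))) (F.+-identityʳ F.1#)))
                                 w₀≈0)

    rowFibre-nonzero : ∀ {r : Vector F.Carrier (suc m)} → ¬ (∀ l → r l F.≈ F.0#) → rowFibre r ≈ rowFibre (idM Fin.zero)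
    rowFibre-nonzero {r} r≉0 = trans (rowFibre-orbit j rⱼ≉0) (rowFibre-unitRow j)
      where
      j,rⱼ≉0 = ¬∀⟶∃¬ (suc m) _ (λ l → r l ≟ F.0#) r≉0
      j = proj₁ j,rⱼ≉0
      rⱼ≉0 = proj₂ j,rⱼ≉0

    blockInv? : (K : Matrix m) → Dec (Invertible K)
    blockInv? K = Dec.map (M.Invertible-block 0ᵥ K) (inv? (block 0ᵥ K))

    rowFibre-e₀ : rowFibre (idM Fin.zero) ≈ fromℕ (N ^ m) * ΣList (mats m) (𝟙 ∘ blockInv?)
    rowFibre-e₀ = begin
      rowFibre e₀
        ≈⟨ ΣList-allFuns-suc (vecs (suc m)) m _ ⟩
      ΣList (vecs (suc m)) (λ v → ΣList lowerRows (λ K → 𝟙GL (v ∷ᶠ K) * 𝟙 (v ≟ᵥ e₀)))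
        ≈⟨ ΣList-comm (vecs (suc m)) lowerRows _ ⟩
      ΣList lowerRows (λ K → ΣList (vecs (suc m)) (λ v → 𝟙GL (v ∷ᶠ K) * 𝟙 (v ≟ᵥ e₀)))
        ≈⟨ ΣList-cong lowerRows (λ K → trans (ΣList-cong (vecs (suc m)) (λ v → *-comm _ _))
             (ΣList-select (vectorEnumeration R (suc m)) (λ v≈v′ → 𝟙GL-cong (λ { Fin.zero l → v≈v′ l ; (Fin.suc i) l → F.refl })) e₀)) ⟩
      ΣList lowerRows (λ K → 𝟙GL (e₀ ∷ᶠ K))
        ≈⟨ ΣList-allFuns-columns (map ψ (allFin N)) m m (λ K → 𝟙GL (e₀ ∷ᶠ K))
             (λ K≡K′ → 𝟙GL-cong (λ { Fin.zero l → F.refl ; (Fin.suc i) l → F.reflexive (K≡K′ i l) })) ⟩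
      ΣList (vecs m) (λ t → ΣList (mats m) (λ K → 𝟙GL (block t K)))
        ≈⟨ ΣList-cong (vecs m) (λ t → ΣList-cong (mats m) (λ K →
             𝟙-cong (M.Invertible-block t K) (inv? (block t K)) (blockInv? K))) ⟩
      ΣList (vecs m) (λ _ → ΣList (mats m) (𝟙 ∘ blockInv?))
        ≈⟨ ΣList-vecs-const m _ ⟩
      fromℕ (N ^ m) * ΣList (mats m) (𝟙 ∘ blockInv?) ∎
      where
      e₀ = idM Fin.zero
      lowerRows = allFuns (vecs (suc m)) m

    ΣList-byFirstRow : ∀ {G : Vector F.Carrier (suc m) → Carrier} → G Preserves DecSetoid._≈_ (vectorDecSetoid (suc m)) ⟶ _≈_ →
      ΣList (mats (suc m)) (λ K → 𝟙GL K * G (K Fin.zero)) ≈ ΣList (vecs (suc m)) (λ r → rowFibre r * G r)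
    ΣList-byFirstRow {G} G-cong = begin
      ΣList (mats (suc m)) (λ K → 𝟙GL K * G (K Fin.zero))
        ≈⟨ ΣList-cong (mats (suc m)) (λ K → *-congˡ (sym (ΣList-select (vectorEnumeration R (suc m)) G-cong (K Fin.zero)))) ⟩
      ΣList (mats (suc m)) (λ K → 𝟙GL K * ΣList (vecs (suc m)) (λ r → 𝟙 (r ≟ᵥ K Fin.zero) * G r))
        ≈⟨ ΣList-cong (mats (suc m)) (λ K → *-distribˡ-ΣList (vecs (suc m)) (𝟙GL K) _) ⟩
      ΣList (mats (suc m)) (λ K → ΣList (vecs (suc m)) (λ r → 𝟙GL K * (𝟙 (r ≟ᵥ K Fin.zero) * G r)))
        ≈⟨ ΣList-comm (mats (suc m)) (vecs (suc m)) _ ⟩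
      ΣList (vecs (suc m)) (λ r → ΣList (mats (suc m)) (λ K → 𝟙GL K * (𝟙 (r ≟ᵥ K Fin.zero) * G r)))
        ≈⟨ ΣList-cong (vecs (suc m)) (λ r → ΣList-cong (mats (suc m)) (λ K →
             trans (sym (*-assoc _ _ _)) (*-congʳ (*-congˡ (𝟙-cong ≈ᵥ-sym (r ≟ᵥ K Fin.zero) (K Fin.zero ≟ᵥ r)))))) ⟩
      ΣList (vecs (suc m)) (λ r → ΣList (mats (suc m)) (λ K → 𝟙GL K * 𝟙 (K Fin.zero ≟ᵥ r) * G r))
        ≈⟨ ΣList-cong (vecs (suc m)) (λ r → *-distribʳ-ΣList (mats (suc m)) (G r) _) ⟨
      ΣList (vecs (suc m)) (λ r → rowFibre r * G r) ∎
      where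
      ≈ᵥ-sym : ∀ {u v : Vector F.Carrier (suc m)} → (∀ l → u l F.≈ v l) ⇔ (∀ l → v l F.≈ u l)
      ≈ᵥ-sym = mk⇔ (λ u≈v l → F.sym (u≈v l)) (λ v≈u l → F.sym (v≈u l))

    rowFibre-dichotomy : ∀ r → rowFibre r ≈ rowFibre (idM Fin.zero) * (1# + - 𝟙 (r ≟ᵥ 0ᵥ))
    rowFibre-dichotomy r = by-cases (r ≟ᵥ 0ᵥ)
      where
      by-cases : (d : Dec (∀ l → r l F.≈ F.0#)) → rowFibre r ≈ rowFibre (idM Fin.zero) * (1# + - 𝟙 d)
      by-cases (yes r≈0) = trans (rowFibre-zero r≈0) (sym (trans (*-congˡ (-‿inverseʳ 1#)) (zeroʳ _)))
      by-cases (no r≉0)  = trans (rowFibre-nonzero r≉0)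
                                 (sym (trans (*-congˡ (trans (+-congˡ -0#≈0#) (+-identityʳ 1#))) (*-identityʳ _)))

    ΣList-invertible-byFirstRow : ∀ {G : Vector F.Carrier (suc m) → Carrier} →
      G Preserves DecSetoid._≈_ (vectorDecSetoid (suc m)) ⟶ _≈_ →
      ΣList (mats (suc m)) (λ K → 𝟙GL K * G (K Fin.zero)) ≈ rowFibre (idM Fin.zero) * (ΣList (vecs (suc m)) G + - G 0ᵥ)
    ΣList-invertible-byFirstRow {G} G-cong = begin
      ΣList (mats (suc m)) (λ K → 𝟙GL K * G (K Fin.zero))
        ≈⟨ ΣList-byFirstRow G-cong ⟩
      ΣList (vecs (suc m)) (λ r → rowFibre r * G r)
        ≈⟨ ΣList-cong (vecs (suc m)) (λ r → trans (*-congʳ (rowFibre-dichotomy r)) (*-assoc _ _ _)) ⟩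
      ΣList (vecs (suc m)) (λ r → C * ((1# + - 𝟙 (r ≟ᵥ 0ᵥ)) * G r))
        ≈⟨ *-distribˡ-ΣList (vecs (suc m)) C _ ⟨
      C * ΣList (vecs (suc m)) (λ r → (1# + - 𝟙 (r ≟ᵥ 0ᵥ)) * G r)
        ≈⟨ *-congˡ (ΣList-cong (vecs (suc m)) (λ r → trans (distribʳ _ _ _) (+-cong (*-identityˡ _) (sym (-‿distribˡ-* _ _))))) ⟩
      C * ΣList (vecs (suc m)) (λ r → G r + - (𝟙 (r ≟ᵥ 0ᵥ) * G r))
        ≈⟨ *-congˡ (trans (ΣList-distrib-+ (vecs (suc m)) _ _) (+-congˡ (ΣList-neg (vecs (suc m)) _))) ⟩
      C * (ΣList (vecs (suc m)) G + - ΣList (vecs (suc m)) (λ r → 𝟙 (r ≟ᵥ 0ᵥ) * G r))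
        ≈⟨ *-congˡ (+-congˡ (-‿cong (ΣList-select (vectorEnumeration R (suc m)) G-cong 0ᵥ))) ⟩
      C * (ΣList (vecs (suc m)) G + - G 0ᵥ) ∎
      where
      C = rowFibre (idM Fin.zero)

    ΣList-σ≈firstRowSum : ∀ {g : F.Carrier → Carrier} → g Preserves F._≈_ ⟶ _≈_ →
      ΣList (mats (suc m)) (λ K → 𝟙GL K * g (Ops.σ F K)) ≈ ΣList (mats (suc m)) (λ K → 𝟙GL K * g (Ops.ΣFin F (suc m) (K Fin.zero)))
    ΣList-σ≈firstRowSum {g} g-cong = begin
      ΣList (mats (suc m)) (λ K → 𝟙GL K * g (Ops.σ F K))
        ≈⟨ ΣList-reindex (matrixEnumeration R (suc m)) (matrixEnumeration R (suc m)) (M.mulMˡ-inverse {A = S} {S′} S⁻¹)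
             (λ {K} {K′} K≈K′ → *-cong (𝟙GL-cong K≈K′) (g-cong (M.σ-cong {K = K} {K′} K≈K′))) ⟩
      ΣList (mats (suc m)) (λ K → 𝟙GL (mulM S K) * g (Ops.σ F (mulM S K)))
        ≈⟨ ΣList-cong (mats (suc m)) (λ K → *-cong (𝟙-cong (M.Invertible-*ˡ {A = S} {S′} {K} S⁻¹) (inv? (mulM S K)) (inv? K))
                                                   (g-cong (M.σ-sumToRow Fin.zero K))) ⟩
      ΣList (mats (suc m)) (λ K → 𝟙GL K * g (Ops.ΣFin F (suc m) (K Fin.zero))) ∎
      where
      S = M.sumToRow Fin.zero
      S′ = M.rowUpdate Fin.zero (λ k → F.- (F.1# F.* (idM Fin.zero k F.+ F.- F.1#)))
      S⁻¹ = M.sumToRow-inverses Fin.zero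

  ΣList-𝟙-invertible : .{{_ : ℕ.NonZero N}} → ∀ m (inv? : (K : Matrix m) → Dec (Invertible K)) →
                       ΣList (mats m) (𝟙 ∘ inv?) ≈ fromℕ (glOrder N m)
  rowFibre-e₀-count : .{{_ : ℕ.NonZero N}} → ∀ m (inv? : (K : Matrix (suc m)) → Dec (Invertible K)) →
                      rowFibre inv? (idM Fin.zero) ≈ fromℕ (N ^ m ℕ.* glOrder N m)

  ΣList-𝟙-invertible zero    inv? = +-congʳ (𝟙-yes ((λ ()) , (λ ()) , (λ ())) (inv? (λ ())))
  ΣList-𝟙-invertible (suc m) inv? = begin
    ΣList (mats (suc m)) (𝟙 ∘ inv?)
      ≈⟨ ΣList-cong (mats (suc m)) (λ K → sym (*-identityʳ _)) ⟩
    ΣList (mats (suc m)) (λ K → 𝟙GL inv? K * 1#)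
      ≈⟨ ΣList-invertible-byFirstRow inv? (λ _ → refl) ⟩
    rowFibre inv? (idM Fin.zero) * (ΣList (vecs (suc m)) (λ _ → 1#) + - 1#)
      ≈⟨ *-cong (rowFibre-e₀-count m inv?) (+-congʳ (trans (ΣList-vecs-const (suc m) 1#) (*-identityʳ _))) ⟩
    fromℕ (N ^ m ℕ.* glOrder N m) * (fromℕ (N ^ suc m) + - 1#)
      ≈⟨ *-congˡ (fromℕ-∸1 (N ^ suc m) (ℕ.m^n>0 N (suc m))) ⟨
    fromℕ (N ^ m ℕ.* glOrder N m) * fromℕ (N ^ suc m ℕ.∸ 1)
      ≈⟨ trans (*-comm _ _) (sym (fromℕ-* (N ^ suc m ℕ.∸ 1) _)) ⟩
    fromℕ (glOrder N (suc m)) ∎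

  rowFibre-e₀-count m inv? = begin
    rowFibre inv? (idM Fin.zero)                                   ≈⟨ rowFibre-e₀ inv? ⟩
    fromℕ (N ^ m) * ΣList (mats m) (𝟙 ∘ blockInv? inv?)          ≈⟨ *-congˡ (ΣList-𝟙-invertible m (blockInv? inv?)) ⟩
    fromℕ (N ^ m) * fromℕ (glOrder N m)                           ≈⟨ fromℕ-* (N ^ m) _ ⟨
    fromℕ (N ^ m ℕ.* glOrder N m)                                 ∎

module RootOfUnityWeights (F : CommutativeRing 0ℓ 0ℓ) (N : ℕ)
  (φ : CommutativeRing.Carrier F → Fin N) (ψ : Fin N → CommutativeRing.Carrier F)
  (bij : IsBijection F N φ ψ) (φ0 : toℕ (φ (CommutativeRing.0# F)) ≡ 0)
  (R : CommutativeRing 0ℓ 0ℓ) (R-field : Ops.IsField R)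
  (ω : CommutativeRing.Carrier R) (ω-primitive : Ops.IsPrimitiveRoot R N ω) (N≥2 : 2 ≤ N) where
  open CommutativeRing R hiding (zero)
  open Ops R using (ΣList; pow)
  open FiniteSums R
  open Enumerations R
  open FieldEnumeration F N φ ψ bij
  open IsBijection bij
  private
    module F = CommutativeRing F
  open import Relation.Binary.Reasoning.Setoid setoid

  weight : F.Carrier → Carrier
  weight x = pow ω (toℕ (φ x))

  weight-cong : weight Preserves F._≈_ ⟶ _≈_
  weight-cong x≈y = reflexive (P.cong (pow ω ∘ toℕ) (φ-cong x≈y))

  weight-0# : weight F.0# ≈ 1#
  weight-0# = reflexive (P.cong (pow ω) φ0)

  ΣList-weight : ΣList (elements (enumeration R)) weight ≈ 0#
  ΣList-weight = begin
    ΣList (map ψ (allFin N)) weight                 ≈⟨ ΣList-elements R weight ⟩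
    Ops.ΣFin R N (λ i → pow ω (toℕ (φ (ψ i))))  ≈⟨ ΣFin-cong N (λ i → reflexive (P.cong (pow ω ∘ toℕ) (φψ i))) ⟩
    Ops.ΣFin R N (λ i → pow ω (toℕ i))          ≈⟨ RootsOfUnity.ΣFin-powers≈0 R R-field N (proj₁ ω-primitive) ω≉1 ⟩
    0#                                          ∎
    where
    ω≉1 : ¬ (ω ≈ 1#)
    ω≉1 ω≈1 = proj₂ ω-primitive 1 ℕ.≤-refl N≥2 (trans (*-identityʳ ω) ω≈1)

  ΣList-weight-translate : ∀ s → ΣList (elements (enumeration R)) (λ x → weight (x F.+ s)) ≈ ΣList (elements (enumeration R)) weight
  ΣList-weight-translate s = sym (ΣList-reindex (enumeration R) (enumeration R) translation weight-cong)
    where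
    cancel : ∀ x {s t} → s F.+ t F.≈ F.0# → x F.+ s F.+ t F.≈ x
    cancel x s+t≈0 = F.trans (F.+-assoc x _ _) (F.trans (F.+-congˡ s+t≈0) (F.+-identityʳ x))
    translation : Inverse F.setoid F.setoid
    translation = record
      { to        = F._+ s
      ; from      = F._+ F.- s
      ; to-cong   = F.+-congʳ
      ; from-cong = F.+-congʳ
      ; inverse   = (λ {x} y≈x-s → F.trans (F.+-congʳ y≈x-s) (cancel x (F.-‿inverseˡ s)))
                  , (λ {x} y≈x+s → F.trans (F.+-congʳ y≈x+s) (cancel x (F.-‿inverseʳ s)))
      }

  ΣList-weight∘ΣFin : ∀ m → ΣList (elements (vectorEnumeration R (suc m))) (λ r → weight (Ops.ΣFin F (suc m) r)) ≈ 0#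
  ΣList-weight∘ΣFin m = begin
    ΣList (allFuns Fq (suc m)) (λ r → weight (Ops.ΣFin F (suc m) r))
      ≈⟨ ΣList-allFuns-suc Fq m _ ⟩
    ΣList Fq (λ x → ΣList (allFuns Fq m) (λ r → weight (x F.+ Ops.ΣFin F m r)))
      ≈⟨ ΣList-comm Fq (allFuns Fq m) _ ⟩
    ΣList (allFuns Fq m) (λ r → ΣList Fq (λ x → weight (x F.+ Ops.ΣFin F m r)))
      ≈⟨ ΣList-cong (allFuns Fq m) (λ r → trans (ΣList-weight-translate (Ops.ΣFin F m r)) ΣList-weight) ⟩
    ΣList (allFuns Fq m) (λ _ → 0#)
      ≈⟨ ΣList-zero (allFuns Fq m) ⟩
    0# ∎
    where
    Fq = map ψ (allFin N)

module GLCharacterSum (F : CommutativeRing 0ℓ 0ℓ) (F-field : Ops.IsField F) (N : ℕ)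
  (φ : CommutativeRing.Carrier F → Fin N) (ψ : Fin N → CommutativeRing.Carrier F)
  (bij : IsBijection F N φ ψ) (φ0 : toℕ (φ (CommutativeRing.0# F)) ≡ 0)
  (R : CommutativeRing 0ℓ 0ℓ) (R-field : Ops.IsField R)
  (ω : CommutativeRing.Carrier R) (ω-primitive : Ops.IsPrimitiveRoot R N ω) (N≥2 : 2 ≤ N) where
  open CommutativeRing R hiding (zero)
  open Ops R using (fromℕ)
  open FiniteSums R
  open GLOrder using (glOrder)
  open RowFibres F F-field N φ ψ bij R
  open RootOfUnityWeights F N φ ψ bij φ0 R R-field ω ω-primitive N≥2
  open Ops F using (Matrix; Invertible; idM)
  open import Algebra.Properties.Ring ring using (-‿distribʳ-*)
  open import Relation.Binary.Reasoning.Setoid setoid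

  GLSum≈-q^m|GLₘ| : ∀ m (inv? : (K : Matrix (suc m)) → Dec (Invertible K)) →
                    GLSum F R N φ ψ ω (suc m) inv? ≈ - fromℕ (N ^ m ℕ.* glOrder N m)
  GLSum≈-q^m|GLₘ| m inv? = begin
    GLSum F R N φ ψ ω (suc m) inv?
      ≈⟨ ΣList-filter inv? (mats (suc m)) _ ⟩
    Ops.ΣList R (mats (suc m)) (λ K → 𝟙GL inv? K * weight (Ops.σ F K))
      ≈⟨ ΣList-σ≈firstRowSum inv? weight-cong ⟩
    Ops.ΣList R (mats (suc m)) (λ K → 𝟙GL inv? K * weight (Ops.ΣFin F (suc m) (K Fin.zero)))
      ≈⟨ ΣList-invertible-byFirstRow inv? (λ r≈r′ → weight-cong (FiniteSums.ΣFin-cong F (suc m) r≈r′)) ⟩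
    C * (Ops.ΣList R (vecs (suc m)) (weight ∘ Ops.ΣFin F (suc m)) + - weight (Ops.ΣFin F (suc m) 0ᵥ))
      ≈⟨ *-congˡ (+-cong (ΣList-weight∘ΣFin m) (-‿cong (trans (weight-cong (FiniteSums.ΣFin-zero F (suc m))) weight-0#))) ⟩
    C * (0# + - 1#)
      ≈⟨ trans (*-congˡ (+-identityˡ _)) (sym (-‿distribʳ-* C 1#)) ⟩
    - (C * 1#)
      ≈⟨ -‿cong (trans (*-identityʳ C) (rowFibre-e₀-count {{ℕ.>-nonZero (ℕ.<⇒≤ N≥2)}} m inv?)) ⟩
    - fromℕ (N ^ m ℕ.* glOrder N m) ∎
    where
    C = rowFibre inv? (idM Fin.zero)

prime^k≥2 : ∀ {p} k → Prime p → 1 ≤ k → 2 ≤ p ^ k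
prime^k≥2 {p} k p-prime k≥1 = ℕ.≤-trans (ℕ.nonTrivial⇒n>1 p {{prime⇒nonTrivial p-prime}})
  (ℕ.≤-trans (ℕ.≤-reflexive (P.sym (ℕ.*-identityʳ p))) (ℕ.^-monoʳ-≤ p {{prime⇒nonZero p-prime}} k≥1))

theorem3p1 : (p k : ℕ) → Prime p → 1 ≤ k →
    (F : CommutativeRing 0ℓ 0ℓ) → Ops.IsField F →
    (φ : CommutativeRing.Carrier F → Fin (p ^ k)) → (ψ : Fin (p ^ k) → CommutativeRing.Carrier F) →
    IsBijection F (p ^ k) φ ψ → toℕ (φ (CommutativeRing.0# F)) ≡ 0 →
    (R : CommutativeRing 0ℓ 0ℓ) → Ops.IsField R → Ops.CharZero R →
    (ω : CommutativeRing.Carrier R) → Ops.IsPrimitiveRoot R (p ^ k) ω →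
    (n : ℕ) → 1 ≤ n → (inv? : (K : Ops.Matrix F n) → Dec (Ops.Invertible F K)) →
    CommutativeRing._≈_ R (GLSum F R (p ^ k) φ ψ ω n inv?)
      (CommutativeRing.-_ R (Ops.fromℕ R (rhsNat (p ^ k) n)))
theorem3p1 p k p-prime k≥1 F F-field φ ψ bij φ0 R R-field _ ω ω-primitive (suc m) _ inv? =
  R.trans (GLCharacterSum.GLSum≈-q^m|GLₘ| F F-field q φ ψ bij φ0 R R-field ω ω-primitive q≥2 m inv?)
          (R.-‿cong (R.reflexive (P.cong (Ops.fromℕ R) (GLOrder.q^m*glOrder≡rhsNat (ℕ.<⇒≤ q≥2) m))))
  where
  module R = CommutativeRing R
  q = p ^ k
  q≥2 = prime^k≥2 k p-prime k≥1
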